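{- Let $N\ge 2$, let $n_1\ge 0$ and $n_2,\dots,n_N\ge 1$ be integers, write $|n|=n_2+\cdots+n_N$ and $|k|=k_2+\cdots+k_N$, and let $s$ be a fixed vertex of the complete $N$-partite graph $K_{n_1+1,n_2,\dots,n_N}$. The number of acyclic orientations of $K_{n_1+1,n_2,\dots,n_N}$ whose unique sink is $s$ equals \[ \sum_{(k_2,\dots,k_N)\in[n_2]\times\cdots\times[n_N]} (-1)^{|n|-|k|}\,|k|^{n_1}\,|k|!\,\prod_{i=2}^N \left\{ {n_i \atop k_i} \right\}, \] where $\left\{ {a \atop b} \right\}$ is the Stirling number of the second kind.
   Context: $K_{m_1,\dots,m_N}$ is the complete multipartite graph with parts of sizes $m_1,\dots,m_N$, two vertices adjacent iff in different parts. An acyclic orientation is an orientation of all edges with no directed cycle; a sink is a vertex with no outgoing edge. The number of acyclic orientations with unique sink equal to $s$ does not depend on the choice of $s$. $[a]=\{1,\dots,a\}$. -}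

module Defs where

import Data.Nat
open import Data.Nat using (ℕ; zero; suc; _+_; _*_; _∸_; _≤_)
open import Data.Nat using (_!)
open import Data.Integer as ℤ using (ℤ; +_; -1ℤ)
open import Data.Fin using (Fin; zero; suc)
open import Data.Bool using (Bool; true; false; not)
open import Data.Product using (Σ; _×_; _,_; proj₁)
open import Data.List using (List; []; _∷_; _++_; [_]; length)
open import Data.List.Relation.Unary.Linked using (Linked)
open import Data.List.Relation.Unary.AllPairs using (AllPairs)
open import Data.List.Relation.Unary.Any using (Any)
open import Data.List.Relation.Unary.All using (All)
open import Data.List.Relation.Unary.Unique.Propositional using (Unique)
open import Relation.Binary.PropositionalEquality using (_≡_)
open import Relation.Nullary using (¬_)

S₂ : ℕ → ℕ → ℕ
S₂ zero    zero    = 1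
S₂ zero    (suc k) = 0
S₂ (suc n) zero    = 0
S₂ (suc n) (suc k) = suc k * S₂ n (suc k) + S₂ n k

-- Complete multipartite graph with parts of sizes m : Fin N → ℕ.
-- Vertices are pairs (part index, index inside the part);
-- two vertices are adjacent iff they lie in different parts.

Vertex : {N : ℕ} → (Fin N → ℕ) → Set
Vertex {N} m = Σ (Fin N) (λ i → Fin (m i))

SamePart : {N : ℕ} {m : Fin N → ℕ} → Vertex m → Vertex m → Set
SamePart u v = proj₁ u ≡ proj₁ v

-- A candidate orientation: o u v ≡ true means the edge uv is directed u → v.
Rel₂ : {N : ℕ} → (Fin N → ℕ) → Set
Rel₂ m = Vertex m → Vertex m → Bool

IsOrientation : {N : ℕ} {m : Fin N → ℕ} → Rel₂ m → Set
IsOrientation {m = m} o =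
  (u v : Vertex m) →
    (SamePart {m = m} u v → o u v ≡ false) ×
    (¬ SamePart {m = m} u v → o u v ≡ not (o v u))

Arc : {N : ℕ} {m : Fin N → ℕ} → Rel₂ m → Vertex m → Vertex m → Set
Arc o u v = o u v ≡ true

-- A directed cycle: distinct vertices v ∷ l with arcs v → l₁ → … → lₖ → v.
-- (Since there are no loops, l is necessarily nonempty.)
DirectedCycle : {N : ℕ} {m : Fin N → ℕ} → Rel₂ m → Set
DirectedCycle {m = m} o =
  Σ (Vertex m) λ v → Σ (List (Vertex m)) λ l →
    Linked (Arc o) (v ∷ l ++ [ v ]) × Unique (v ∷ l)

IsAcyclic : {N : ℕ} {m : Fin N → ℕ} → Rel₂ m → Set
IsAcyclic o = ¬ DirectedCycle o

IsSink : {N : ℕ} {m : Fin N → ℕ} → Rel₂ m → Vertex m → Set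
IsSink {m = m} o u = (w : Vertex m) → ¬ Arc o u w

UniqueSink : {N : ℕ} {m : Fin N → ℕ} → Rel₂ m → Vertex m → Set
UniqueSink {m = m} o s = IsSink o s × ((u : Vertex m) → IsSink o u → u ≡ s)

AcyclicWithUniqueSink : {N : ℕ} {m : Fin N → ℕ} → Vertex m → Rel₂ m → Set
AcyclicWithUniqueSink s o = IsOrientation o × IsAcyclic o × UniqueSink o s

_≗₂_ : {N : ℕ} {m : Fin N → ℕ} → Rel₂ m → Rel₂ m → Set
_≗₂_ {m = m} o o′ = (u v : Vertex m) → o u v ≡ o′ u v

-- L is an exhaustive duplicate-free list of the orientations satisfying P
-- (up to pointwise equality); hence the number of them is length L.
Enumerates : {N : ℕ} {m : Fin N → ℕ} → (Rel₂ m → Set) → List (Rel₂ m) → Set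
Enumerates {m = m} P L =
  AllPairs (λ o o′ → ¬ (o ≗₂ o′)) L ×
  All P L ×
  ((o : Rel₂ m) → P o → Any (λ o′ → o ≗₂ o′) L)

NumAcyclicUniqueSink : {N : ℕ} (m : Fin N → ℕ) → Vertex m → ℕ → Set
NumAcyclicUniqueSink m s c =
  Σ (List (Rel₂ m)) λ L →
    Enumerates (AcyclicWithUniqueSink {m = m} s) L × length L ≡ c

-- Part sizes (n₁ + 1, n₂, …, n_N) with N = suc K; ns j = n_{j+2}.

sizes : (K n₁ : ℕ) → (Fin K → ℕ) → Fin (suc K) → ℕ
sizes K n₁ ns zero    = suc n₁
sizes K n₁ ns (suc j) = ns j

∣_∣ₜ : {K : ℕ} → (Fin K → ℕ) → ℕ
∣_∣ₜ {zero}  x = 0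
∣_∣ₜ {suc K} x = x zero + ∣ (λ j → x (suc j)) ∣ₜ

sum1to : ℕ → (ℕ → ℤ) → ℤ
sum1to zero    f = + 0
sum1to (suc a) f = sum1to a f ℤ.+ f (suc a)

consT : {K : ℕ} → ℕ → (Fin K → ℕ) → Fin (suc K) → ℕ
consT k ks zero    = k
consT k ks (suc j) = ks j

sumBox : (K : ℕ) → (Fin K → ℕ) → ((Fin K → ℕ) → ℤ) → ℤ
sumBox zero    ns f = f (λ ())
sumBox (suc K) ns f =
  sum1to (ns zero) λ k → sumBox K (λ j → ns (suc j)) (λ ks → f (consT k ks))

∏S₂ : {K : ℕ} → (Fin K → ℕ) → (Fin K → ℕ) → ℕ
∏S₂ {zero}  ns ks = 1
∏S₂ {suc K} ns ks = S₂ (ns zero) (ks zero) * ∏S₂ (λ j → ns (suc j)) (λ j → ks (suc j))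

formula : (K n₁ : ℕ) → (Fin K → ℕ) → ℤ
formula K n₁ ns =
  sumBox K ns λ ks →
    (-1ℤ ℤ.^ (∣ ns ∣ₜ ∸ ∣ ks ∣ₜ)) ℤ.*
    + (∣ ks ∣ₜ Data.Nat.^ n₁ * (∣ ks ∣ₜ !) * ∏S₂ ns ks)

-- Write a for the vector of part sizes. Deleting the unique sink s, which lies in part p,
-- leaves an acyclic orientation of K_{a - e_p} with no sink in part p, and every such
-- orientation arises exactly once (all vertices outside part p point to s). In an acyclic
-- orientation of a complete multipartite graph the sinks form a nonempty subset B of a single
-- part q, and deleting them leaves an orientation with no sink in part q; this gives a
-- recursion for the number of acyclic orientations with no sink in a given part. The
-- inclusion-exclusion expression 𝒩 a p = Σ_d (-1)^d C(a_p,d) 𝒜(a - d e_p), with 𝒜 a the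
-- (Stanley) count of all acyclic orientations, satisfies the same recursion by binomial
-- inversion. Finally Σ_d C(A,d) S(A-d,j) = S(A+1,j+1) turns 𝒩 (a - e_p) p into a single
-- signed Stirling sum 𝒰 a, in which the sum over k₁ is evaluated by
-- Σ_j (-1)^(A+j) S(A,j) (j+m-1)! = m^(A-1) m!, while the terms with some other k_i = 0 vanish.

module Submission where

open import Data.Nat as ℕ using (ℕ; zero; suc; _∸_; _≤_; _<_; z≤n; s≤s; _!)
import Data.Nat.Properties as ℕP
open import Data.Nat.Combinatorics using (_C_; nCk+nC[k+1]≡[n+1]C[k+1]; k>n⇒nCk≡0)
import Data.Nat.Tactic.RingSolver as NS
open import Data.Integer as ℤ using (ℤ; +_; -1ℤ; 0ℤ; 1ℤ; _+_; _*_; -_; _-_)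
import Data.Integer.Properties as ℤP
open import Data.Integer.Tactic.RingSolver
open import Data.Bool using (Bool; true; false; if_then_else_; not; _∧_; _∨_)
import Data.Bool.Properties as BoolP
open import Data.Fin as F using (Fin; zero; suc; _≟_)
import Data.Fin.Properties as FP
open import Data.Product using (Σ; _×_; _,_; proj₁; proj₂)
import Data.Product.Properties as PP
open import Data.Sum using (_⊎_; inj₁; inj₂)
open import Data.Empty using (⊥; ⊥-elim)
open import Data.Unit using (⊤; tt)
open import Data.Vec as Vec using (Vec; []; _∷_; lookup; tabulate; _[_]≔_)
import Data.Vec.Properties as VP
open import Data.List as L using (List; []; _∷_; _++_; [_]; length; map; concatMap; allFin)
import Data.List.Properties as LP
open import Data.List.Relation.Unary.All as All using (All; []; _∷_)
open import Data.List.Relation.Unary.Any as Any using (Any; here; there)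
open import Data.List.Relation.Unary.AllPairs as AP using (AllPairs; []; _∷_)
open import Data.List.Relation.Unary.Linked as Lk using (Linked; []; [-]; _∷_)
import Data.List.Relation.Unary.Any.Properties as Anyₚ
import Data.List.Relation.Unary.All.Properties as Allₚ
import Data.List.Relation.Unary.AllPairs.Properties as AllPairsₚ
open import Data.List.Membership.Propositional using (_∈_; find)
open import Data.List.Membership.Propositional.Properties using (∈-++⁻; ∈-map⁻; ∈-allFin)
open import Relation.Nullary using (¬_; Dec; yes; no; does)
open import Relation.Nullary.Decidable using (dec-true; dec-false)
open import Relation.Binary.PropositionalEquality hiding ([_])
open import Data.Vec.Functional using () renaming (_∷_ to _∷ᵇ_)
open import Function using (_∘_)
open import Defs

-- Finite sums

sum0to : ℕ → (ℕ → ℤ) → ℤ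
sum0to zero    f = f 0
sum0to (suc n) f = sum0to n f + f (suc n)

sum0to-cong : ∀ n {f g : ℕ → ℤ} → (∀ j → j ≤ n → f j ≡ g j) → sum0to n f ≡ sum0to n g
sum0to-cong zero    e = e 0 z≤n
sum0to-cong (suc n) e = cong₂ _+_ (sum0to-cong n (λ j j≤n → e j (ℕP.m≤n⇒m≤1+n j≤n))) (e (suc n) ℕP.≤-refl)

sum0to-+ : ∀ n (f g : ℕ → ℤ) → sum0to n (λ j → f j + g j) ≡ sum0to n f + sum0to n g
sum0to-+ zero f g = refl
sum0to-+ (suc n) f g rewrite sum0to-+ n f g = interchange (sum0to n f) (sum0to n g) (f (suc n)) (g (suc n))
  where
  interchange : ∀ a b c d → a + b + (c + d) ≡ a + c + (b + d)
  interchange = solve-∀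

sum0to-* : ∀ n c (f : ℕ → ℤ) → sum0to n (λ j → c * f j) ≡ c * sum0to n f
sum0to-* zero c f = refl
sum0to-* (suc n) c f rewrite sum0to-* n c f = sym (ℤP.*-distribˡ-+ c (sum0to n f) (f (suc n)))

sum0to-≡0 : ∀ n {f : ℕ → ℤ} → (∀ j → j ≤ n → f j ≡ 0ℤ) → sum0to n f ≡ 0ℤ
sum0to-≡0 zero e = e 0 z≤n
sum0to-≡0 (suc n) e rewrite sum0to-≡0 n (λ j j≤n → e j (ℕP.m≤n⇒m≤1+n j≤n)) | e (suc n) ℕP.≤-refl = refl

sum0to-suc : ∀ n (f : ℕ → ℤ) → sum0to (suc n) f ≡ f 0 + sum0to n (f ∘ suc)
sum0to-suc zero f = refl
sum0to-suc (suc n) f rewrite sum0to-suc n f = ℤP.+-assoc (f 0) (sum0to n (f ∘ suc)) (f (suc (suc n)))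

sum0to-≡head : ∀ n (f : ℕ → ℤ) → (∀ j → f (suc j) ≡ 0ℤ) → sum0to n f ≡ f 0
sum0to-≡head zero f e = refl
sum0to-≡head (suc n) f e rewrite sum0to-≡head n f e | e n = ℤP.+-identityʳ (f 0)

sum0to-extend : ∀ n m (f : ℕ → ℤ) → n ≤ m → (∀ j → n < j → f j ≡ 0ℤ) → sum0to n f ≡ sum0to m f
sum0to-extend n zero f z≤n e = refl
sum0to-extend n (suc m) f n≤1+m e with ℕP.m≤n⇒m<n∨m≡n n≤1+m
... | inj₁ (s≤s n≤m) rewrite e (suc m) (s≤s n≤m) =
  trans (sum0to-extend n m f n≤m e) (sym (ℤP.+-identityʳ (sum0to m f)))
... | inj₂ refl = refl

sum0to-shift : ∀ n (f : ℕ → ℤ) → f 0 ≡ 0ℤ → f (suc n) ≡ 0ℤ → sum0to n f ≡ sum0to n (f ∘ suc)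
sum0to-shift n f e0 en = begin
  sum0to n f                 ≡⟨ sym (ℤP.+-identityʳ _) ⟩
  sum0to n f + 0ℤ            ≡⟨ cong (λ x → sum0to n f + x) (sym en) ⟩
  sum0to (suc n) f           ≡⟨ sum0to-suc n f ⟩
  f 0 + sum0to n (f ∘ suc)   ≡⟨ cong (_+ sum0to n (f ∘ suc)) e0 ⟩
  0ℤ + sum0to n (f ∘ suc)    ≡⟨ ℤP.+-identityˡ _ ⟩
  sum0to n (f ∘ suc) ∎
  where open ≡-Reasoning

sum0to≡head+sum1to : ∀ n (f : ℕ → ℤ) → sum0to n f ≡ f 0 + sum1to n f
sum0to≡head+sum1to zero f = sym (ℤP.+-identityʳ (f 0))
sum0to≡head+sum1to (suc n) f rewrite sum0to≡head+sum1to n f = ℤP.+-assoc (f 0) (sum1to n f) (f (suc n))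

sum1to-cong : ∀ n {f g : ℕ → ℤ} → (∀ j → j ≤ n → f j ≡ g j) → sum1to n f ≡ sum1to n g
sum1to-cong zero    e = refl
sum1to-cong (suc n) e = cong₂ _+_ (sum1to-cong n (λ j j≤n → e j (ℕP.m≤n⇒m≤1+n j≤n))) (e (suc n) ℕP.≤-refl)

sum1to-* : ∀ n c (f : ℕ → ℤ) → sum1to n (λ j → c * f j) ≡ c * sum1to n f
sum1to-* zero c f = sym (ℤP.*-zeroʳ c)
sum1to-* (suc n) c f rewrite sum1to-* n c f = sym (ℤP.*-distribˡ-+ c (sum1to n f) (f (suc n)))

-- Signs, binomial coefficients and Stirling numbers

binomℤ : ℕ → ℕ → ℤ
binomℤ n k = + (n C k)

-1^ : ℕ → ℤ
-1^ n = -1ℤ ℤ.^ n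

-1^-+ : ∀ m n → -1^ (m ℕ.+ n) ≡ -1^ m * -1^ n
-1^-+ m n = ℤP.^-distribˡ-+-* -1ℤ m n

-1^-suc : ∀ n → -1^ (suc n) ≡ - -1^ n
-1^-suc n = ℤP.-1*i≡-i (-1^ n)

-1^-square : ∀ n → -1^ n * -1^ n ≡ 1ℤ
-1^-square zero = refl
-1^-square (suc n) rewrite -1^-suc n = trans (neg*neg (-1^ n)) (-1^-square n)
  where
  neg*neg : ∀ x → (- x) * (- x) ≡ x * x
  neg*neg = solve-∀

S₂-≡0 : ∀ n k → n < k → S₂ n k ≡ 0
S₂-≡0 zero (suc k) _ = refl
S₂-≡0 (suc n) (suc k) (s≤s n<k) rewrite S₂-≡0 n (suc k) (ℕP.m≤n⇒m≤1+n n<k) | S₂-≡0 n k n<k = trans (ℕP.+-identityʳ _) (ℕP.*-zeroʳ k)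

signedS₂ : ℕ → ℕ → ℤ
signedS₂ a j = -1^ (a ℕ.+ j) * + S₂ a j

signedS₂-≡0 : ∀ a j → a < j → signedS₂ a j ≡ 0ℤ
signedS₂-≡0 a j a<j rewrite S₂-≡0 a j a<j = ℤP.*-zeroʳ (-1^ (a ℕ.+ j))

factℤ : ℕ → ℤ
factℤ n = + (n !)

-- Sums over boxes 0 ≤ k ≤ a

boxSum : ∀ {N} → Vec ℕ N → (Vec ℕ N → ℤ) → ℤ
boxSum [] F = F []
boxSum (x ∷ xs) F = sum0to x (λ j → boxSum xs (λ k → F (j ∷ k)))

boxSum-cong : ∀ {N} (a : Vec ℕ N) {F G : Vec ℕ N → ℤ} → (∀ k → F k ≡ G k) → boxSum a F ≡ boxSum a G
boxSum-cong [] e = e []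
boxSum-cong (x ∷ a) e = sum0to-cong x (λ j _ → boxSum-cong a (λ k → e (j ∷ k)))

boxSum-+ : ∀ {N} (a : Vec ℕ N) (F G : Vec ℕ N → ℤ) → boxSum a (λ k → F k + G k) ≡ boxSum a F + boxSum a G
boxSum-+ [] F G = refl
boxSum-+ (x ∷ a) F G = trans (sum0to-cong x (λ j _ → boxSum-+ a (λ k → F (j ∷ k)) (λ k → G (j ∷ k))))
                            (sum0to-+ x _ _)

boxSum-* : ∀ {N} (a : Vec ℕ N) c (F : Vec ℕ N → ℤ) → boxSum a (λ k → c * F k) ≡ c * boxSum a F
boxSum-* [] c F = refl
boxSum-* (x ∷ a) c F = trans (sum0to-cong x (λ j _ → boxSum-* a c (λ k → F (j ∷ k)))) (sum0to-* x c _)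

boxSum-≡0 : ∀ {N} (a : Vec ℕ N) {F : Vec ℕ N → ℤ} → (∀ k → F k ≡ 0ℤ) → boxSum a F ≡ 0ℤ
boxSum-≡0 [] e = e []
boxSum-≡0 (x ∷ a) e = sum0to-≡0 x (λ j _ → boxSum-≡0 a (λ k → e (j ∷ k)))

boxSum-sum0to : ∀ {N} (a : Vec ℕ N) n (F : ℕ → Vec ℕ N → ℤ) →
  boxSum a (λ k → sum0to n (λ j → F j k)) ≡ sum0to n (λ j → boxSum a (F j))
boxSum-sum0to a zero F = refl
boxSum-sum0to a (suc n) F = trans (boxSum-+ a _ _) (cong (_+ boxSum a (F (suc n))) (boxSum-sum0to a n F))

boxSum-sum1to : ∀ {N} (a : Vec ℕ N) n (F : ℕ → Vec ℕ N → ℤ) →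
  boxSum a (λ k → sum1to n (λ j → F j k)) ≡ sum1to n (λ j → boxSum a (F j))
boxSum-sum1to a zero F = boxSum-≡0 a (λ _ → refl)
boxSum-sum1to a (suc n) F = trans (boxSum-+ a _ _) (cong (_+ boxSum a (F (suc n))) (boxSum-sum1to a n F))

sumFin : ∀ {N} → (Fin N → ℤ) → ℤ
sumFin {zero} f = 0ℤ
sumFin {suc N} f = f zero + sumFin (f ∘ suc)

sumFin-cong : ∀ {N} {f g : Fin N → ℤ} → (∀ q → f q ≡ g q) → sumFin f ≡ sumFin g
sumFin-cong {zero} e = refl
sumFin-cong {suc N} e = cong₂ _+_ (e zero) (sumFin-cong (e ∘ suc))

sumFin-*ʳ : ∀ {N} (f : Fin N → ℤ) c → sumFin (λ q → f q * c) ≡ sumFin f * c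
sumFin-*ʳ {zero} f c = sym (ℤP.*-zeroˡ c)
sumFin-*ʳ {suc N} f c rewrite sumFin-*ʳ (f ∘ suc) c = sym (ℤP.*-distribʳ-+ c (f zero) (sumFin (f ∘ suc)))

boxSum-sumFin : ∀ {N M} (a : Vec ℕ N) (F : Fin M → Vec ℕ N → ℤ) →
  boxSum a (λ k → sumFin (λ q → F q k)) ≡ sumFin (λ q → boxSum a (F q))
boxSum-sumFin {M = zero} a F = boxSum-≡0 a (λ _ → refl)
boxSum-sumFin {M = suc M} a F = trans (boxSum-+ a _ _) (cong (λ z → boxSum a (F zero) + z) (boxSum-sumFin a (F ∘ suc)))

sumFin-lookup : ∀ {N} (k : Vec ℕ N) → sumFin (λ q → + lookup k q) ≡ + Vec.sum k
sumFin-lookup [] = refl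
sumFin-lookup (x ∷ k) rewrite sumFin-lookup k = sym (ℤP.pos-+ x (Vec.sum k))

δ₀ : ℕ → ℤ
δ₀ zero = 1ℤ
δ₀ (suc _) = 0ℤ

boxSum-δ₀ : ∀ {N} (a : Vec ℕ N) (X : Vec ℕ N → ℤ) → boxSum a (λ k → δ₀ (Vec.sum k) * X k) ≡ X (Vec.replicate _ 0)
boxSum-δ₀ [] X = ℤP.*-identityˡ (X [])
boxSum-δ₀ (x ∷ a) X = trans (sum0to-≡head x _ (λ j → boxSum-≡0 a (λ k → ℤP.*-zeroˡ (X (suc j ∷ k)))))
                            (boxSum-δ₀ a (λ k → X (0 ∷ k)))

boxSum-zeros : ∀ {N} (F : Vec ℕ N → ℤ) → boxSum (Vec.replicate N 0) F ≡ F (Vec.replicate _ 0)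
boxSum-zeros {zero} F = refl
boxSum-zeros {suc N} F = boxSum-zeros (λ k → F (0 ∷ k))

boxSum-shift : ∀ {N} (a : Vec ℕ N) (p : Fin N) (G : Vec ℕ N → ℤ) →
  (∀ k → lookup k p ≡ 0 → G k ≡ 0ℤ) → (∀ k → lookup k p ≡ suc (lookup a p) → G k ≡ 0ℤ) →
  boxSum a G ≡ boxSum a (λ k → G (k [ p ]≔ suc (lookup k p)))
boxSum-shift (x ∷ a) zero G e0 e1 =
  sum0to-shift x (λ j → boxSum a (λ k → G (j ∷ k))) (boxSum-≡0 a (λ k → e0 (0 ∷ k) refl)) (boxSum-≡0 a (λ k → e1 (suc x ∷ k) refl))
boxSum-shift (x ∷ a) (suc p) G e0 e1 =
  sum0to-cong x (λ j _ → boxSum-shift a p (λ k → G (j ∷ k)) (λ k → e0 (j ∷ k)) (λ k → e1 (j ∷ k)))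

boxSum-extend : ∀ {N} (a : Vec ℕ N) (p : Fin N) x y (G : Vec ℕ N → ℤ) → x ≤ y →
  (∀ k → x < lookup k p → G k ≡ 0ℤ) → boxSum (a [ p ]≔ x) G ≡ boxSum (a [ p ]≔ y) G
boxSum-extend (z ∷ a) zero x y G x≤y e =
  sum0to-extend x y _ x≤y (λ j x<j → boxSum-≡0 a (λ k → e (j ∷ k) x<j))
boxSum-extend (z ∷ a) (suc p) x y G x≤y e =
  sum0to-cong z (λ j _ → boxSum-extend a p x y (λ k → G (j ∷ k)) x≤y (λ k → e (j ∷ k)))

∏signedS₂ : ∀ {N} → Vec ℕ N → Vec ℕ N → ℤ
∏signedS₂ [] [] = 1ℤ
∏signedS₂ (a ∷ as) (k ∷ ks) = signedS₂ a k * ∏signedS₂ as ks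

∏signedS₂-except : ∀ {N} → Vec ℕ N → Vec ℕ N → Fin N → ℤ
∏signedS₂-except (a ∷ as) (k ∷ ks) zero = ∏signedS₂ as ks
∏signedS₂-except (a ∷ as) (k ∷ ks) (suc p) = signedS₂ a k * ∏signedS₂-except as ks p

∏signedS₂-split : ∀ {N} (a k : Vec ℕ N) p → ∏signedS₂ a k ≡ signedS₂ (lookup a p) (lookup k p) * ∏signedS₂-except a k p
∏signedS₂-split (a ∷ as) (k ∷ ks) zero = refl
∏signedS₂-split (a ∷ as) (k ∷ ks) (suc p) rewrite ∏signedS₂-split as ks p = swap-front (signedS₂ a k) (signedS₂ (lookup as p) (lookup ks p)) (∏signedS₂-except as ks p)
  where
  swap-front : ∀ x y z → x * (y * z) ≡ y * (x * z)
  swap-front = solve-∀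

∏signedS₂-except-updateᵃ : ∀ {N} (a k : Vec ℕ N) p x → ∏signedS₂-except (a [ p ]≔ x) k p ≡ ∏signedS₂-except a k p
∏signedS₂-except-updateᵃ (a ∷ as) (k ∷ ks) zero x = refl
∏signedS₂-except-updateᵃ (a ∷ as) (k ∷ ks) (suc p) x = cong (signedS₂ a k *_) (∏signedS₂-except-updateᵃ as ks p x)

∏signedS₂-except-updateᵏ : ∀ {N} (a k : Vec ℕ N) p x → ∏signedS₂-except a (k [ p ]≔ x) p ≡ ∏signedS₂-except a k p
∏signedS₂-except-updateᵏ (a ∷ as) (k ∷ ks) zero x = refl
∏signedS₂-except-updateᵏ (a ∷ as) (k ∷ ks) (suc p) x = cong (signedS₂ a k *_) (∏signedS₂-except-updateᵏ as ks p x)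

∏signedS₂-update : ∀ {N} (a k : Vec ℕ N) p x → ∏signedS₂ (a [ p ]≔ x) k ≡ signedS₂ x (lookup k p) * ∏signedS₂-except a k p
∏signedS₂-update a k p x rewrite ∏signedS₂-split (a [ p ]≔ x) k p | VP.lookup∘update p a x | ∏signedS₂-except-updateᵃ a k p x = refl

sum-increment : ∀ {N} (k : Vec ℕ N) p → Vec.sum (k [ p ]≔ suc (lookup k p)) ≡ suc (Vec.sum k)
sum-increment (x ∷ k) zero = refl
sum-increment (x ∷ k) (suc p) rewrite sum-increment k p = ℕP.+-suc x (Vec.sum k)

lowerAt : ∀ {N} → Vec ℕ N → Fin N → ℕ → Vec ℕ N
lowerAt a q b = a [ q ]≔ (lookup a q ∸ b)

sum-lowerAt : ∀ {N} (a : Vec ℕ N) q b → b ≤ lookup a q → Vec.sum (lowerAt a q b) ℕ.+ b ≡ Vec.sum a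
sum-lowerAt (x ∷ a) zero b b≤x = trans (ℕP.+-assoc (x ∸ b) (Vec.sum a) b)
  (trans (cong ((x ∸ b) ℕ.+_) (ℕP.+-comm (Vec.sum a) b))
  (trans (sym (ℕP.+-assoc (x ∸ b) b (Vec.sum a))) (cong (ℕ._+ Vec.sum a) (ℕP.m∸n+n≡m b≤x))))
sum-lowerAt (x ∷ a) (suc q) b b≤ = trans (ℕP.+-assoc x (Vec.sum (lowerAt a q b)) b) (cong (x ℕ.+_) (sum-lowerAt a q b b≤))

lowerAt-lowerAt : ∀ {N} (a : Vec ℕ N) q b d → lowerAt (lowerAt a q b) q d ≡ lowerAt a q (b ℕ.+ d)
lowerAt-lowerAt (x ∷ a) zero b d = cong (_∷ a) (ℕP.∸-+-assoc x b d)
lowerAt-lowerAt (x ∷ a) (suc q) b d = cong (x ∷_) (lowerAt-lowerAt a q b d)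

lowerAt-0 : ∀ {N} (a : Vec ℕ N) q → lowerAt a q 0 ≡ a
lowerAt-0 (x ∷ a) zero = refl
lowerAt-0 (x ∷ a) (suc q) = cong (x ∷_) (lowerAt-0 a q)

increment-lowerAt-1 : ∀ {N} (a : Vec ℕ N) p → 1 ≤ lookup a p → lowerAt a p 1 [ p ]≔ suc (lookup (lowerAt a p 1) p) ≡ a
increment-lowerAt-1 (suc x ∷ a) zero _ = refl
increment-lowerAt-1 (x ∷ a) (suc p) h = cong (x ∷_) (increment-lowerAt-1 a p h)

sum0to-peel : ∀ n (F : ℕ → ℤ) → F (suc n) ≡ 0ℤ → sum0to n F ≡ F 0 + sum0to n (F ∘ suc)
sum0to-peel n F e = trans (sym (ℤP.+-identityʳ _)) (trans (cong (λ z → sum0to n F + z) (sym e)) (sum0to-suc n F))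

sum0to-pascal : ∀ n (g : ℕ → ℤ) →
  sum0to (suc n) (λ b → binomℤ (suc n) b * g b) ≡ sum0to n (λ b → binomℤ n b * g b) + sum0to n (λ b → binomℤ n b * g (suc b))
sum0to-pascal n g = begin
  sum0to (suc n) (λ b → binomℤ (suc n) b * g b)
    ≡⟨ sum0to-suc n _ ⟩
  1ℤ * g 0 + sum0to n (λ b → binomℤ (suc n) (suc b) * g (suc b))
    ≡⟨ cong (λ z → 1ℤ * g 0 + z) (trans (sum0to-cong n (λ b _ → trans (cong (_* g (suc b)) (trans (cong +_ (sym (nCk+nC[k+1]≡[n+1]C[k+1] n b))) (ℤP.pos-+ (n C b) (n C suc b))))
                                          (ℤP.*-distribʳ-+ (g (suc b)) (binomℤ n b) (binomℤ n (suc b)))))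
                                      (sum0to-+ n _ _)) ⟩
  1ℤ * g 0 + (P2 + P1)
    ≡⟨ reassoc (g 0) P1 P2 ⟩
  (1ℤ * g 0 + P1) + P2
    ≡⟨ cong (_+ P2) (sym (sum0to-peel n (λ b → binomℤ n b * g b) last-vanishes)) ⟩
  sum0to n (λ b → binomℤ n b * g b) + P2 ∎
  where
  open ≡-Reasoning
  P1 = sum0to n (λ b → binomℤ n (suc b) * g (suc b))
  P2 = sum0to n (λ b → binomℤ n b * g (suc b))
  last-vanishes : binomℤ n (suc n) * g (suc n) ≡ 0ℤ
  last-vanishes rewrite k>n⇒nCk≡0 (ℕP.n<1+n n) = ℤP.*-zeroˡ (g (suc n))
  reassoc : ∀ a x y → 1ℤ * a + (y + x) ≡ (1ℤ * a + x) + y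
  reassoc = solve-∀

sum1to≡sum0to-head : ∀ n (f : ℕ → ℤ) → sum1to n f ≡ sum0to n f - f 0
sum1to≡sum0to-head n f = trans (sym (cancel-head (f 0) (sum1to n f))) (cong (_- f 0) (sym (sum0to≡head+sum1to n f)))
  where
  cancel-head : ∀ h s → h + s - h ≡ s
  cancel-head = solve-∀

sum1to-pascal : ∀ n (g : ℕ → ℤ) →
  sum1to (suc n) (λ b → binomℤ (suc n) b * g b) ≡ sum0to n (λ b → binomℤ n b * g (suc b)) + sum1to n (λ b → binomℤ n b * g b)
sum1to-pascal n g = begin
  sum1to (suc n) (λ b → binomℤ (suc n) b * g b)
    ≡⟨ sum1to≡sum0to-head (suc n) _ ⟩
  sum0to (suc n) (λ b → binomℤ (suc n) b * g b) - 1ℤ * g 0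
    ≡⟨ cong (_- 1ℤ * g 0) (sum0to-pascal n g) ⟩
  sum0to n (λ b → binomℤ n b * g b) + P - 1ℤ * g 0
    ≡⟨ cong (λ z → z + P - 1ℤ * g 0) (sum0to≡head+sum1to n _) ⟩
  1ℤ * g 0 + sum1to n (λ b → binomℤ n b * g b) + P - 1ℤ * g 0
    ≡⟨ drop-head (1ℤ * g 0) _ P ⟩
  P + sum1to n (λ b → binomℤ n b * g b) ∎
  where
  open ≡-Reasoning
  P = sum0to n (λ b → binomℤ n b * g (suc b))
  drop-head : ∀ h s t → h + s + t - h ≡ t + s
  drop-head = solve-∀

S₂-1 : ∀ n → S₂ (suc n) 1 ≡ 1
S₂-1 zero = refl
S₂-1 (suc n) rewrite S₂-1 n = refl

S₂-suc-sucℤ : ∀ n k → + S₂ (suc n) (suc k) ≡ + suc k * + S₂ n (suc k) + + S₂ n k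
S₂-suc-sucℤ n k = trans (ℤP.pos-+ (suc k ℕ.* S₂ n (suc k)) (S₂ n k)) (cong (_+ + S₂ n k) (ℤP.pos-* (suc k) (S₂ n (suc k))))

mutual
  S₂-suc-binomial : ∀ A j → sum0to A (λ d → binomℤ A d * + S₂ (A ∸ d) j) ≡ + S₂ (suc A) (suc j)
  S₂-suc-binomial zero zero = refl
  S₂-suc-binomial zero (suc j) = sym (cong +_ (S₂-≡0 1 (suc (suc j)) (s≤s (s≤s z≤n))))
  S₂-suc-binomial (suc A) j = begin
    sum0to (suc A) (λ d → binomℤ (suc A) d * + S₂ (suc A ∸ d) j)
      ≡⟨ sum0to-pascal A (λ d → + S₂ (suc A ∸ d) j) ⟩
    sum0to A (λ d → binomℤ A d * + S₂ (suc A ∸ d) j) + sum0to A (λ d → binomℤ A d * + S₂ (A ∸ d) j)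
      ≡⟨ cong₂ _+_ (sum0to-cong A (λ d d≤A → cong (λ z → binomℤ A d * + S₂ z j) (ℕP.+-∸-assoc 1 d≤A))) (S₂-suc-binomial A j) ⟩
    sum0to A (λ d → binomℤ A d * + S₂ (suc (A ∸ d)) j) + + S₂ (suc A) (suc j)
      ≡⟨ S₂-suc-binomial-shifted A j ⟩
    + S₂ (suc (suc A)) (suc j) ∎
    where open ≡-Reasoning

  S₂-suc-binomial-shifted : ∀ A j →
    sum0to A (λ d → binomℤ A d * + S₂ (suc (A ∸ d)) j) + + S₂ (suc A) (suc j) ≡ + S₂ (suc (suc A)) (suc j)
  S₂-suc-binomial-shifted A zero = begin
    sum0to A (λ d → binomℤ A d * 0ℤ) + + S₂ (suc A) 1
      ≡⟨ cong (_+ + S₂ (suc A) 1) (sum0to-≡0 A (λ d _ → ℤP.*-zeroʳ (binomℤ A d))) ⟩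
    0ℤ + + S₂ (suc A) 1
      ≡⟨ ℤP.+-identityˡ _ ⟩
    + S₂ (suc A) 1
      ≡⟨ cong +_ (trans (S₂-1 A) (sym (S₂-1 (suc A)))) ⟩
    + S₂ (suc (suc A)) 1 ∎
    where open ≡-Reasoning
  S₂-suc-binomial-shifted A (suc j) = begin
    sum0to A (λ d → binomℤ A d * + S₂ (suc (A ∸ d)) (suc j)) + y
      ≡⟨ cong (_+ y) (sum0to-cong A (λ d _ → trans (cong (binomℤ A d *_) (S₂-suc-sucℤ (A ∸ d) j))
                                                 (distribute (binomℤ A d) (+ suc j) _ _))) ⟩
    sum0to A (λ d → + suc j * (binomℤ A d * + S₂ (A ∸ d) (suc j)) + binomℤ A d * + S₂ (A ∸ d) j) + y
      ≡⟨ cong (_+ y) (sum0to-+ A _ _) ⟩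
    sum0to A (λ d → + suc j * (binomℤ A d * + S₂ (A ∸ d) (suc j))) + sum0to A (λ d → binomℤ A d * + S₂ (A ∸ d) j) + y
      ≡⟨ cong (_+ y) (cong₂ _+_ (trans (sum0to-* A (+ suc j) _) (cong (+ suc j *_) (S₂-suc-binomial A (suc j))))
                                (S₂-suc-binomial A j)) ⟩
    + suc j * y + x + y
      ≡⟨ regroup (+ suc j) x y ⟩
    (1ℤ + + suc j) * y + x
      ≡⟨ S₂-suc-sucℤ (suc A) (suc j) ⟨
    + S₂ (suc (suc A)) (suc (suc j)) ∎
    where
    open ≡-Reasoning
    x = + S₂ (suc A) (suc j)
    y = + S₂ (suc A) (suc (suc j))
    distribute : ∀ b s u v → b * (s * u + v) ≡ s * (b * u) + b * v
    distribute = solve-∀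
    regroup : ∀ s u v → s * v + u + v ≡ (1ℤ + s) * v + u
    regroup = solve-∀

-1^-2+ : ∀ n → -1^ (suc (suc n)) ≡ -1^ n
-1^-2+ n = trans (-1^-suc (suc n)) (trans (cong -_ (-1^-suc n)) (ℤP.neg-involutive (-1^ n)))

-1^-+suc : ∀ A j → -1^ (A ℕ.+ suc j) ≡ - -1^ (A ℕ.+ j)
-1^-+suc A j = trans (cong -1^ (ℕP.+-suc A j)) (-1^-suc (A ℕ.+ j))

-1^-suc+suc : ∀ A j → -1^ (suc A ℕ.+ suc j) ≡ -1^ (A ℕ.+ j)
-1^-suc+suc A j = trans (cong (λ z → -1^ (suc z)) (ℕP.+-suc A j)) (-1^-2+ (A ℕ.+ j))

signedS₂-suc-binomial : ∀ A j → sum0to A (λ d → binomℤ A d * -1^ d * signedS₂ (A ∸ d) j) ≡ signedS₂ (suc A) (suc j)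
signedS₂-suc-binomial A j = begin
  sum0to A (λ d → binomℤ A d * -1^ d * signedS₂ (A ∸ d) j)
    ≡⟨ sum0to-cong A (λ d d≤A → term d d≤A) ⟩
  sum0to A (λ d → -1^ (A ℕ.+ j) * (binomℤ A d * + S₂ (A ∸ d) j))
    ≡⟨ sum0to-* A (-1^ (A ℕ.+ j)) (λ d → binomℤ A d * + S₂ (A ∸ d) j) ⟩
  -1^ (A ℕ.+ j) * sum0to A (λ d → binomℤ A d * + S₂ (A ∸ d) j)
    ≡⟨ cong₂ _*_ (sym (-1^-suc+suc A j)) (S₂-suc-binomial A j) ⟩
  signedS₂ (suc A) (suc j) ∎
  where
  open ≡-Reasoning
  regroup : ∀ b s t x → b * s * (t * x) ≡ (s * t) * (b * x)
  regroup = solve-∀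
  term : ∀ d → d ≤ A → binomℤ A d * -1^ d * signedS₂ (A ∸ d) j ≡ -1^ (A ℕ.+ j) * (binomℤ A d * + S₂ (A ∸ d) j)
  term d d≤A = trans (regroup (binomℤ A d) (-1^ d) (-1^ ((A ∸ d) ℕ.+ j)) (+ S₂ (A ∸ d) j))
    (cong (_* (binomℤ A d * + S₂ (A ∸ d) j))
      (trans (sym (-1^-+ d ((A ∸ d) ℕ.+ j)))
        (cong -1^ (trans (sym (ℕP.+-assoc d (A ∸ d) j)) (cong (ℕ._+ j) (ℕP.m+[n∸m]≡n d≤A))))))

signedS₂-binomial-tail : ∀ A j → + suc j * signedS₂ A (suc j) ≡ - sum1to A (λ b → binomℤ A b * -1^ b * signedS₂ (A ∸ b) j)
signedS₂-binomial-tail A j = begin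
  + suc j * signedS₂ A (suc j)
    ≡⟨ cong (λ z → + suc j * (z * + S₂ A (suc j))) (-1^-+suc A j) ⟩
  + suc j * ((- σ) * x)
    ≡⟨ expand σ x y (+ suc j) ⟩
  - (σ * (+ suc j * x + y) - 1ℤ * 1ℤ * (σ * y))
    ≡⟨ cong (λ z → - (z - 1ℤ * 1ℤ * (σ * y))) (cong (σ *_) (sym (S₂-suc-sucℤ A j))) ⟩
  - (σ * + S₂ (suc A) (suc j) - 1ℤ * 1ℤ * (σ * y))
    ≡⟨ cong (λ z → - (z * + S₂ (suc A) (suc j) - 1ℤ * 1ℤ * (σ * y))) (sym (-1^-suc+suc A j)) ⟩
  - (signedS₂ (suc A) (suc j) - 1ℤ * 1ℤ * signedS₂ A j)
    ≡⟨ cong -_ peel-head ⟩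
  - sum1to A g ∎
  where
  open ≡-Reasoning
  σ = -1^ (A ℕ.+ j)
  x = + S₂ A (suc j)
  y = + S₂ A j
  g = λ b → binomℤ A b * -1^ b * signedS₂ (A ∸ b) j
  expand : ∀ σ x y s → s * ((- σ) * x) ≡ - (σ * (s * x + y) - 1ℤ * 1ℤ * (σ * y))
  expand = solve-∀
  peel-head : signedS₂ (suc A) (suc j) - 1ℤ * 1ℤ * signedS₂ A j ≡ sum1to A g
  peel-head = begin
    signedS₂ (suc A) (suc j) - 1ℤ * 1ℤ * signedS₂ A j ≡⟨ cong (_- g 0) (sym (signedS₂-suc-binomial A j)) ⟩
    sum0to A g - g 0 ≡⟨ cong (_- g 0) (sum0to≡head+sum1to A g) ⟩
    g 0 + sum1to A g - g 0 ≡⟨ cancel-head (g 0) (sum1to A g) ⟩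
    sum1to A g ∎
    where
    cancel-head : ∀ a b → a + b - a ≡ b
    cancel-head = solve-∀

sum0to-neg : ∀ n (f : ℕ → ℤ) → sum0to n (λ j → - f j) ≡ - sum0to n f
sum0to-neg n f = trans (sum0to-cong n (λ j _ → sym (ℤP.-1*i≡-i (f j))))
                (trans (sum0to-* n -1ℤ f) (ℤP.-1*i≡-i (sum0to n f)))

stirlingSum : ℕ → ℕ → ℤ
stirlingSum A m = sum0to A (λ j → signedS₂ A j * factℤ (j ℕ.+ m ∸ 1))

factℤ-suc : ∀ n → factℤ (suc n) ≡ + suc n * factℤ n
factℤ-suc n = ℤP.pos-* (suc n) (n !)

stirlingTerm : ℕ → ℕ → ℕ → ℤ
stirlingTerm A m j = -1^ (A ℕ.+ j) * + S₂ A (suc j) * factℤ (j ℕ.+ m)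

stirlingSum-shift : ∀ A m → stirlingSum (suc A) m ≡ sum0to (suc A) (λ j → - stirlingTerm (suc A) m j)
stirlingSum-shift A m = begin
  sum0to (suc A) G
    ≡⟨ sum0to-shift (suc A) G (trans (cong (_* factℤ (m ∸ 1)) (ℤP.*-zeroʳ (-1^ (suc A ℕ.+ 0)))) (ℤP.*-zeroˡ (factℤ (m ∸ 1))))
         (trans (cong (_* factℤ (suc (suc A) ℕ.+ m ∸ 1)) (signedS₂-≡0 (suc A) (suc (suc A)) ℕP.≤-refl)) (ℤP.*-zeroˡ (factℤ (suc (suc A) ℕ.+ m ∸ 1)))) ⟩
  sum0to (suc A) (G ∘ suc)
    ≡⟨ sum0to-cong (suc A) (λ j _ → trans (cong (λ a → a * + S₂ (suc A) (suc j) * factℤ (j ℕ.+ m)) (-1^-+suc (suc A) j))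
                        (pull-neg (-1^ (suc A ℕ.+ j)) (+ S₂ (suc A) (suc j)) (factℤ (j ℕ.+ m)))) ⟩
  sum0to (suc A) (λ j → - stirlingTerm (suc A) m j) ∎
  where
  open ≡-Reasoning
  G = λ j → signedS₂ (suc A) j * factℤ (j ℕ.+ m ∸ 1)
  pull-neg : ∀ σ x f → (- σ) * x * f ≡ - (σ * x * f)
  pull-neg = solve-∀

stirlingSum-suc : ∀ n m → stirlingSum (suc (suc n)) m ≡ + m * stirlingSum (suc n) m
stirlingSum-suc n m = begin
  stirlingSum (suc A') m
    ≡⟨ sum0to-suc A' F ⟩
  F 0 + sum0to A' (F ∘ suc)
    ≡⟨ cong (_+ sum0to A' (F ∘ suc)) F-head ⟩
  0ℤ + sum0to A' (F ∘ suc)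
    ≡⟨ ℤP.+-identityˡ _ ⟩
  sum0to A' (F ∘ suc)
    ≡⟨ sum0to-cong A' (λ j _ → F-suc j) ⟩
  sum0to A' (λ j → + suc j * u j + H j)
    ≡⟨ sum0to-+ A' (λ j → + suc j * u j) H ⟩
  sum0to A' (λ j → + suc j * u j) + sum0to A' H
    ≡⟨ cong (λ z → sum0to A' (λ j → + suc j * u j) + z) (sum0to-shift A' H H-head H-last) ⟩
  sum0to A' (λ j → + suc j * u j) + sum0to A' (H ∘ suc)
    ≡⟨ sum0to-+ A' (λ j → + suc j * u j) (H ∘ suc) ⟨
  sum0to A' (λ j → + suc j * u j + H (suc j))
    ≡⟨ sum0to-cong A' (λ j _ → combine j) ⟩
  sum0to A' (λ j → + m * (- u j))
    ≡⟨ sum0to-* A' (+ m) (λ j → - u j) ⟩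
  + m * sum0to A' (λ j → - u j)
    ≡⟨ cong (+ m *_) (stirlingSum-shift n m) ⟨
  + m * stirlingSum A' m ∎
  where
  open ≡-Reasoning
  A' = suc n
  F = λ j → signedS₂ (suc A') j * factℤ (j ℕ.+ m ∸ 1)
  u = stirlingTerm A' m
  H = λ j → -1^ (A' ℕ.+ j) * + S₂ A' j * factℤ (j ℕ.+ m)
  F-head : F 0 ≡ 0ℤ
  F-head = trans (cong (_* factℤ (m ∸ 1)) (ℤP.*-zeroʳ (-1^ (suc A' ℕ.+ 0)))) (ℤP.*-zeroˡ (factℤ (m ∸ 1)))
  H-head : H 0 ≡ 0ℤ
  H-head = trans (cong (_* factℤ m) (ℤP.*-zeroʳ (-1^ (A' ℕ.+ 0)))) (ℤP.*-zeroˡ (factℤ m))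
  H-last : H (suc A') ≡ 0ℤ
  H-last rewrite S₂-≡0 A' (suc A') ℕP.≤-refl =
    trans (cong (_* factℤ (suc A' ℕ.+ m)) (ℤP.*-zeroʳ (-1^ (A' ℕ.+ suc A')))) (ℤP.*-zeroˡ (factℤ (suc A' ℕ.+ m)))
  distribute : ∀ σ s x y f → σ * (s * x + y) * f ≡ s * (σ * x * f) + σ * y * f
  distribute = solve-∀
  F-suc : ∀ j → F (suc j) ≡ + suc j * u j + H j
  F-suc j = trans (cong₂ (λ a b → a * b * factℤ (j ℕ.+ m)) (-1^-suc+suc A' j) (S₂-suc-sucℤ A' j))
                  (distribute (-1^ (A' ℕ.+ j)) (+ suc j) (+ S₂ A' (suc j)) (+ S₂ A' j) (factℤ (j ℕ.+ m)))
  regroup : ∀ s M σ x f → s * (σ * x * f) + (- σ) * x * ((s + M) * f) ≡ M * (- (σ * x * f))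
  regroup = solve-∀
  combine : ∀ j → + suc j * u j + H (suc j) ≡ + m * (- u j)
  combine j = trans (cong₂ (λ a b → + suc j * u j + a * + S₂ A' (suc j) * b) (-1^-+suc A' j)
                           (trans (factℤ-suc (j ℕ.+ m)) (cong (_* factℤ (j ℕ.+ m)) (ℤP.pos-+ (suc j) m))))
                    (regroup (+ suc j) (+ m) (-1^ (A' ℕ.+ j)) (+ S₂ A' (suc j)) (factℤ (j ℕ.+ m)))

stirlingSum-closed : ∀ n m → stirlingSum (suc n) m ≡ + (m ℕ.^ n ℕ.* m !)
stirlingSum-closed zero m = begin
  signedS₂ 1 0 * factℤ (m ∸ 1) + signedS₂ 1 1 * factℤ m ≡⟨ cong (_+ signedS₂ 1 1 * factℤ m) (ℤP.*-zeroˡ (factℤ (m ∸ 1))) ⟩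
  0ℤ + 1ℤ * factℤ m ≡⟨ trans (ℤP.+-identityˡ _) (ℤP.*-identityˡ _) ⟩
  factℤ m ≡⟨ cong +_ (sym (ℕP.+-identityʳ (m !))) ⟩
  + (1 ℕ.* m !) ∎
  where open ≡-Reasoning
stirlingSum-closed (suc n) m = trans (stirlingSum-suc n m) (trans (cong (+ m *_) (stirlingSum-closed n m))
  (trans (sym (ℤP.pos-* m (m ℕ.^ n ℕ.* m !))) (cong +_ (sym (ℕP.*-assoc m (m ℕ.^ n) (m !))))))

altBinomialSum : ℕ → (ℕ → ℤ) → ℤ
altBinomialSum n G = sum0to n (λ d → binomℤ n d * -1^ d * G d)

altBinomialSum-cong : ∀ n {G G' : ℕ → ℤ} → (∀ d → d ≤ n → G d ≡ G' d) → altBinomialSum n G ≡ altBinomialSum n G'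
altBinomialSum-cong n e = sum0to-cong n (λ d d≤n → cong (binomℤ n d * -1^ d *_) (e d d≤n))

altBinomialSum-suc : ∀ n G → altBinomialSum (suc n) G ≡ altBinomialSum n G - altBinomialSum n (G ∘ suc)
altBinomialSum-suc n G = begin
  altBinomialSum (suc n) G
    ≡⟨ sum0to-cong (suc n) (λ d _ → ℤP.*-assoc (binomℤ (suc n) d) (-1^ d) (G d)) ⟩
  sum0to (suc n) (λ d → binomℤ (suc n) d * (-1^ d * G d))
    ≡⟨ sum0to-pascal n (λ d → -1^ d * G d) ⟩
  sum0to n (λ d → binomℤ n d * (-1^ d * G d)) + sum0to n (λ d → binomℤ n d * (-1^ (suc d) * G (suc d)))
    ≡⟨ cong₂ _+_ (sum0to-cong n (λ d _ → sym (ℤP.*-assoc (binomℤ n d) (-1^ d) (G d))))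
                 (trans (sum0to-cong n (λ d _ → trans (cong (λ z → binomℤ n d * (z * G (suc d))) (-1^-suc d)) (pull-neg (binomℤ n d) (-1^ d) (G (suc d)))))
                        (sum0to-neg n (λ d → binomℤ n d * -1^ d * G (suc d)))) ⟩
  altBinomialSum n G - altBinomialSum n (G ∘ suc) ∎
  where
  open ≡-Reasoning
  pull-neg : ∀ b s g → b * ((- s) * g) ≡ - (b * s * g)
  pull-neg = solve-∀

binomialOfAltSums : ℕ → (ℕ → ℤ) → ℤ
binomialOfAltSums A F = sum0to A (λ b → binomℤ A b * altBinomialSum (A ∸ b) (λ d → F (b ℕ.+ d)))

binomial-inversion : ∀ A F → binomialOfAltSums A F ≡ F 0
binomial-inversion zero F = cancel (F 0)
  where
  cancel : ∀ x → 1ℤ * (1ℤ * 1ℤ * x) ≡ x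
  cancel = solve-∀
binomial-inversion (suc A) F = begin
  binomialOfAltSums (suc A) F
    ≡⟨ sum0to-pascal A (λ b → altBinomialSum (suc A ∸ b) (λ d → F (b ℕ.+ d))) ⟩
  sum0to A (λ b → binomℤ A b * altBinomialSum (suc A ∸ b) (λ d → F (b ℕ.+ d))) + binomialOfAltSums A (F ∘ suc)
    ≡⟨ cong (_+ binomialOfAltSums A (F ∘ suc)) (sum0to-cong A (λ b b≤A → cong (binomℤ A b *_) (split-step b b≤A))) ⟩
  sum0to A (λ b → binomℤ A b * (altBinomialSum (A ∸ b) (λ d → F (b ℕ.+ d)) - altBinomialSum (A ∸ b) (λ d → F (suc b ℕ.+ d)))) + binomialOfAltSums A (F ∘ suc)
    ≡⟨ cong (_+ binomialOfAltSums A (F ∘ suc)) (trans (sum0to-cong A (λ b _ → ℤP.*-distribˡ-+ (binomℤ A b) _ _))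
         (trans (sum0to-+ A _ _) (cong (λ z → binomialOfAltSums A F + z) (trans (sum0to-cong A (λ b _ → sym (ℤP.neg-distribʳ-* (binomℤ A b) _)))
            (sum0to-neg A (λ b → binomℤ A b * altBinomialSum (A ∸ b) (λ d → F (suc b ℕ.+ d)))))))) ⟩
  binomialOfAltSums A F - binomialOfAltSums A (F ∘ suc) + binomialOfAltSums A (F ∘ suc)
    ≡⟨ cancel (binomialOfAltSums A F) (binomialOfAltSums A (F ∘ suc)) ⟩
  binomialOfAltSums A F
    ≡⟨ binomial-inversion A F ⟩
  F 0 ∎
  where
  open ≡-Reasoning
  cancel : ∀ x y → x - y + y ≡ x
  cancel = solve-∀
  split-step : ∀ b → b ≤ A → altBinomialSum (suc A ∸ b) (λ d → F (b ℕ.+ d)) ≡ altBinomialSum (A ∸ b) (λ d → F (b ℕ.+ d)) - altBinomialSum (A ∸ b) (λ d → F (suc b ℕ.+ d))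
  split-step b b≤A rewrite ℕP.+-∸-assoc 1 b≤A =
    trans (altBinomialSum-suc (A ∸ b) (λ d → F (b ℕ.+ d)))
      (cong (λ z → altBinomialSum (A ∸ b) (λ d → F (b ℕ.+ d)) - z) (altBinomialSum-cong (A ∸ b) (λ d _ → cong F (ℕP.+-suc b d))))

binomial-inversion-tail : ∀ A F → sum1to A (λ b → binomℤ A b * altBinomialSum (A ∸ b) (λ d → F (b ℕ.+ d))) ≡ F 0 - altBinomialSum A F
binomial-inversion-tail A F = begin
  sum1to A g ≡⟨ insert-head (altBinomialSum A F) (sum1to A g) ⟩
  1ℤ * altBinomialSum A F + sum1to A g - altBinomialSum A F ≡⟨ cong (_- altBinomialSum A F) (trans (sym (sum0to≡head+sum1to A g)) (binomial-inversion A F)) ⟩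
  F 0 - altBinomialSum A F ∎
  where
  open ≡-Reasoning
  g = λ b → binomℤ A b * altBinomialSum (A ∸ b) (λ d → F (b ℕ.+ d))
  insert-head : ∀ p s → s ≡ 1ℤ * p + s - p
  insert-head = solve-∀

-- The closed forms

-- 𝒜 a = (-1)^|a| χ(K_a, -1), Stanley's count of the acyclic orientations of K_a.
𝒜 : ∀ {N} → Vec ℕ N → ℤ
𝒜 a = boxSum a (λ k → factℤ (Vec.sum k) * ∏signedS₂ a k)

-- Inclusion-exclusion over the sinks in part p: the acyclic orientations with no sink there.
𝒩 : ∀ {N} → Vec ℕ N → Fin N → ℤ
𝒩 a p = altBinomialSum (lookup a p) (λ d → 𝒜 (lowerAt a p d))

𝒮 : ∀ {N} → Vec ℕ N → Fin N → ℤ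
𝒮 a q = - sum1to (lookup a q) (λ b → binomℤ (lookup a q) b * -1^ b * 𝒜 (lowerAt a q b))

𝒮≡𝒜-𝒩 : ∀ {N} (a : Vec ℕ N) q → 𝒮 a q ≡ 𝒜 a - 𝒩 a q
𝒮≡𝒜-𝒩 a q = begin
  - S1 ≡⟨ neg-as-difference (𝒜 a) S1 ⟩
  𝒜 a - (1ℤ * 1ℤ * 𝒜 a + S1) ≡⟨ cong (λ z → 𝒜 a - (1ℤ * 1ℤ * 𝒜 z + S1)) (sym (lowerAt-0 a q)) ⟩
  𝒜 a - (g 0 + S1) ≡⟨ cong (λ z → 𝒜 a - z) (sym (sum0to≡head+sum1to A g)) ⟩
  𝒜 a - 𝒩 a q ∎
  where
  open ≡-Reasoning
  A = lookup a q
  g = λ d → binomℤ A d * -1^ d * 𝒜 (lowerAt a q d)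
  S1 = sum1to A g
  neg-as-difference : ∀ c s → - s ≡ c - (1ℤ * 1ℤ * c + s)
  neg-as-difference = solve-∀

𝒜-lowerAt : ∀ {N} (a : Vec ℕ N) q b →
  𝒜 (lowerAt a q b) ≡ boxSum a (λ k → factℤ (Vec.sum k) * signedS₂ (lookup a q ∸ b) (lookup k q) * ∏signedS₂-except a k q)
𝒜-lowerAt a q b = begin
  boxSum (lowerAt a q b) (λ k → factℤ (Vec.sum k) * ∏signedS₂ (lowerAt a q b) k)
    ≡⟨ boxSum-cong (lowerAt a q b) (λ k → trans (cong (factℤ (Vec.sum k) *_) (∏signedS₂-update a k q (lookup a q ∸ b)))
                                          (sym (ℤP.*-assoc (factℤ (Vec.sum k)) _ _))) ⟩
  boxSum (a [ q ]≔ (lookup a q ∸ b)) W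
    ≡⟨ boxSum-extend a q (lookup a q ∸ b) (lookup a q) W (ℕP.m∸n≤m (lookup a q) b)
         (λ k lt → trans (cong (λ z → z * ∏signedS₂-except a k q) (trans (cong (factℤ (Vec.sum k) *_) (signedS₂-≡0 _ _ lt)) (ℤP.*-zeroʳ (factℤ (Vec.sum k)))))
                    (ℤP.*-zeroˡ (∏signedS₂-except a k q))) ⟩
  boxSum (a [ q ]≔ lookup a q) W
    ≡⟨ cong (λ z → boxSum z W) (VP.[]≔-lookup a q) ⟩
  boxSum a W ∎
  where
  open ≡-Reasoning
  W = λ k → factℤ (Vec.sum k) * signedS₂ (lookup a q ∸ b) (lookup k q) * ∏signedS₂-except a k q

𝒮-boxSum : ∀ {N} (a : Vec ℕ N) q → 𝒮 a q ≡ boxSum a (λ k → + lookup k q * factℤ (Vec.sum k ∸ 1) * ∏signedS₂ a k)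
𝒮-boxSum a q = begin
  - sum1to A (λ b → binomℤ A b * -1^ b * 𝒜 (lowerAt a q b))
    ≡⟨ cong -_ (sum1to-cong A (λ b _ → trans (cong (binomℤ A b * -1^ b *_) (𝒜-lowerAt a q b)) (sym (boxSum-* a (binomℤ A b * -1^ b) (W b))))) ⟩
  - sum1to A (λ b → boxSum a (λ k → binomℤ A b * -1^ b * W b k))
    ≡⟨ cong -_ (sym (boxSum-sum1to a A (λ b k → binomℤ A b * -1^ b * W b k))) ⟩
  - boxSum a (λ k → sum1to A (λ b → binomℤ A b * -1^ b * W b k))
    ≡⟨ trans (sym (ℤP.-1*i≡-i _)) (sym (boxSum-* a -1ℤ _)) ⟩
  boxSum a (λ k → -1ℤ * sum1to A (λ b → binomℤ A b * -1^ b * W b k))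
    ≡⟨ boxSum-cong a term ⟩
  boxSum a (λ k → G (k [ q ]≔ suc (lookup k q)))
    ≡⟨ sym (boxSum-shift a q G (λ k e → vanishes-at-0 k e) (λ k e → vanishes-above k e)) ⟩
  boxSum a G
    ≡⟨ boxSum-cong a (λ k → cong (+ lookup k q * factℤ (Vec.sum k ∸ 1) *_) (sym (∏signedS₂-split a k q))) ⟩
  boxSum a (λ k → + lookup k q * factℤ (Vec.sum k ∸ 1) * ∏signedS₂ a k) ∎
  where
  open ≡-Reasoning
  A = lookup a q
  W = λ b k → factℤ (Vec.sum k) * signedS₂ (A ∸ b) (lookup k q) * ∏signedS₂-except a k q
  G = λ k → + lookup k q * factℤ (Vec.sum k ∸ 1) * (signedS₂ A (lookup k q) * ∏signedS₂-except a k q)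
  vanishes-at-0 : ∀ k → lookup k q ≡ 0 → G k ≡ 0ℤ
  vanishes-at-0 k e rewrite e = trans (cong (_* (signedS₂ A 0 * ∏signedS₂-except a k q)) (ℤP.*-zeroˡ (factℤ (Vec.sum k ∸ 1)))) (ℤP.*-zeroˡ (signedS₂ A 0 * ∏signedS₂-except a k q))
  vanishes-above : ∀ k → lookup k q ≡ suc A → G k ≡ 0ℤ
  vanishes-above k e rewrite e | signedS₂-≡0 A (suc A) ℕP.≤-refl =
    trans (cong (+ suc A * factℤ (Vec.sum k ∸ 1) *_) (ℤP.*-zeroˡ (∏signedS₂-except a k q))) (ℤP.*-zeroʳ (+ suc A * factℤ (Vec.sum k ∸ 1)))
  pull-neg : ∀ f p s → -1ℤ * (f * p * s) ≡ f * (- s) * p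
  pull-neg = solve-∀
  regroup : ∀ b σ f c p → b * σ * (f * c * p) ≡ f * p * (b * σ * c)
  regroup = solve-∀
  regroup′ : ∀ f s c p → f * (s * c) * p ≡ s * f * (c * p)
  regroup′ = solve-∀
  term : ∀ k → -1ℤ * sum1to A (λ b → binomℤ A b * -1^ b * W b k) ≡ G (k [ q ]≔ suc (lookup k q))
  term k = begin
    -1ℤ * sum1to A (λ b → binomℤ A b * -1^ b * W b k)
      ≡⟨ cong (-1ℤ *_) (trans (sum1to-cong A (λ b _ → regroup (binomℤ A b) (-1^ b) (factℤ (Vec.sum k)) (signedS₂ (A ∸ b) (lookup k q)) (∏signedS₂-except a k q)))
                              (sum1to-* A (factℤ (Vec.sum k) * ∏signedS₂-except a k q) (λ b → binomℤ A b * -1^ b * signedS₂ (A ∸ b) (lookup k q)))) ⟩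
    -1ℤ * (factℤ (Vec.sum k) * ∏signedS₂-except a k q * sum1to A (λ b → binomℤ A b * -1^ b * signedS₂ (A ∸ b) (lookup k q)))
      ≡⟨ pull-neg (factℤ (Vec.sum k)) (∏signedS₂-except a k q) (sum1to A (λ b → binomℤ A b * -1^ b * signedS₂ (A ∸ b) (lookup k q))) ⟩
    factℤ (Vec.sum k) * (- sum1to A (λ b → binomℤ A b * -1^ b * signedS₂ (A ∸ b) (lookup k q))) * ∏signedS₂-except a k q
      ≡⟨ cong (λ z → factℤ (Vec.sum k) * z * ∏signedS₂-except a k q) (sym (signedS₂-binomial-tail A (lookup k q))) ⟩
    factℤ (Vec.sum k) * (+ suc (lookup k q) * signedS₂ A (suc (lookup k q))) * ∏signedS₂-except a k q
      ≡⟨ regroup′ (factℤ (Vec.sum k)) (+ suc (lookup k q)) (signedS₂ A (suc (lookup k q))) (∏signedS₂-except a k q) ⟩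
    + suc (lookup k q) * factℤ (Vec.sum k) * (signedS₂ A (suc (lookup k q)) * ∏signedS₂-except a k q)
      ≡⟨ cong (λ z → + suc (lookup k q) * factℤ (Vec.sum k) * (signedS₂ A (suc (lookup k q)) * z)) (sym (∏signedS₂-except-updateᵏ a k q _)) ⟩
    + suc (lookup k q) * factℤ (Vec.sum k) * (signedS₂ A (suc (lookup k q)) * ∏signedS₂-except a k' q)
      ≡⟨ sym (cong₂ (λ x y → + x * factℤ (y ∸ 1) * (signedS₂ A x * ∏signedS₂-except a k' q)) (VP.lookup∘update q k (suc (lookup k q))) (sum-increment k q)) ⟩
    G k' ∎
    where k' = k [ q ]≔ suc (lookup k q)

∏signedS₂-zeros : ∀ {N} (a : Vec ℕ N) → ∏signedS₂ a (Vec.replicate _ 0) ≡ δ₀ (Vec.sum a)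
∏signedS₂-zeros [] = refl
∏signedS₂-zeros (zero ∷ a) = trans (ℤP.*-identityˡ (∏signedS₂ a (Vec.replicate _ 0))) (∏signedS₂-zeros a)
∏signedS₂-zeros (suc x ∷ a) = trans (cong (_* ∏signedS₂ a (Vec.replicate _ 0)) (ℤP.*-zeroʳ (-1^ (suc x ℕ.+ 0)))) (ℤP.*-zeroˡ (∏signedS₂ a (Vec.replicate _ 0)))

boxSum-neg : ∀ {N} (a : Vec ℕ N) (F : Vec ℕ N → ℤ) → boxSum a (λ k → - F k) ≡ - boxSum a F
boxSum-neg a F = trans (boxSum-cong a (λ k → sym (ℤP.-1*i≡-i (F k)))) (trans (boxSum-* a -1ℤ F) (ℤP.-1*i≡-i (boxSum a F)))

factℤ-pred : ∀ n → + n * factℤ (n ∸ 1) ≡ factℤ n - δ₀ n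
factℤ-pred zero = refl
factℤ-pred (suc n) = trans (sym (factℤ-suc n)) (sym (ℤP.+-identityʳ (factℤ (suc n))))

-- Every nonempty acyclic orientation has its sinks in exactly one part.
sumFin-𝒮 : ∀ {N} (a : Vec ℕ N) → sumFin (𝒮 a) ≡ 𝒜 a - δ₀ (Vec.sum a)
sumFin-𝒮 a = begin
  sumFin (𝒮 a)
    ≡⟨ sumFin-cong (𝒮-boxSum a) ⟩
  sumFin (λ q → boxSum a (λ k → + lookup k q * factℤ (Vec.sum k ∸ 1) * ∏signedS₂ a k))
    ≡⟨ sym (boxSum-sumFin a (λ q k → + lookup k q * factℤ (Vec.sum k ∸ 1) * ∏signedS₂ a k)) ⟩
  boxSum a (λ k → sumFin (λ q → + lookup k q * factℤ (Vec.sum k ∸ 1) * ∏signedS₂ a k))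
    ≡⟨ boxSum-cong a term ⟩
  boxSum a (λ k → factℤ (Vec.sum k) * ∏signedS₂ a k + - (δ₀ (Vec.sum k) * ∏signedS₂ a k))
    ≡⟨ trans (boxSum-+ a _ _) (cong (λ z → 𝒜 a + z) (boxSum-neg a (λ k → δ₀ (Vec.sum k) * ∏signedS₂ a k))) ⟩
  𝒜 a - boxSum a (λ k → δ₀ (Vec.sum k) * ∏signedS₂ a k)
    ≡⟨ cong (λ z → 𝒜 a - z) (trans (boxSum-δ₀ a (∏signedS₂ a)) (∏signedS₂-zeros a)) ⟩
  𝒜 a - δ₀ (Vec.sum a) ∎
  where
  open ≡-Reasoning
  reassoc : ∀ n f p → n * f * p ≡ n * (f * p)
  reassoc = solve-∀
  distrib-sub : ∀ f i p → (f - i) * p ≡ f * p + - (i * p)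
  distrib-sub = solve-∀
  term : ∀ k → sumFin (λ q → + lookup k q * factℤ (Vec.sum k ∸ 1) * ∏signedS₂ a k) ≡ factℤ (Vec.sum k) * ∏signedS₂ a k + - (δ₀ (Vec.sum k) * ∏signedS₂ a k)
  term k = begin
    sumFin (λ q → + lookup k q * factℤ (Vec.sum k ∸ 1) * ∏signedS₂ a k)
      ≡⟨ sumFin-cong (λ q → reassoc (+ lookup k q) (factℤ (Vec.sum k ∸ 1)) (∏signedS₂ a k)) ⟩
    sumFin (λ q → + lookup k q * (factℤ (Vec.sum k ∸ 1) * ∏signedS₂ a k))
      ≡⟨ sumFin-*ʳ (λ q → + lookup k q) (factℤ (Vec.sum k ∸ 1) * ∏signedS₂ a k) ⟩
    sumFin (λ q → + lookup k q) * (factℤ (Vec.sum k ∸ 1) * ∏signedS₂ a k)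
      ≡⟨ cong (_* (factℤ (Vec.sum k ∸ 1) * ∏signedS₂ a k)) (sumFin-lookup k) ⟩
    + Vec.sum k * (factℤ (Vec.sum k ∸ 1) * ∏signedS₂ a k)
      ≡⟨ sym (reassoc (+ Vec.sum k) (factℤ (Vec.sum k ∸ 1)) (∏signedS₂ a k)) ⟩
    + Vec.sum k * factℤ (Vec.sum k ∸ 1) * ∏signedS₂ a k
      ≡⟨ cong (_* ∏signedS₂ a k) (factℤ-pred (Vec.sum k)) ⟩
    (factℤ (Vec.sum k) - δ₀ (Vec.sum k)) * ∏signedS₂ a k
      ≡⟨ distrib-sub (factℤ (Vec.sum k)) (δ₀ (Vec.sum k)) (∏signedS₂ a k) ⟩
    factℤ (Vec.sum k) * ∏signedS₂ a k + - (δ₀ (Vec.sum k) * ∏signedS₂ a k) ∎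

unlessEmpty : ℕ → ℤ → ℤ
unlessEmpty zero _ = 1ℤ
unlessEmpty (suc _) x = x

-- The recursion obtained by deleting the sinks; the first argument is fuel, enough once it is ≥ Σ a.
countRec : ∀ {N} → ℕ → Vec ℕ N → Fin N → ℤ
countRec zero a p = 1ℤ
countRec (suc f) a p = unlessEmpty (Vec.sum a) (sumFin (λ q → if does (q ≟ p) then 0ℤ else
                  sum1to (lookup a q) (λ b → binomℤ (lookup a q) b * countRec f (lowerAt a q b) q)))

sumFin-except : ∀ {N} (g : Fin N → ℤ) p → sumFin (λ q → if does (q ≟ p) then 0ℤ else g q) ≡ sumFin g - g p
sumFin-except {suc N} g zero = drop-head (g zero) (sumFin (g ∘ suc))
  where
  drop-head : ∀ x s → 0ℤ + s ≡ x + s - x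
  drop-head = solve-∀
sumFin-except {suc N} g (suc p) = trans (cong (λ z → g zero + z) (sumFin-except (g ∘ suc) p))
  (sym (ℤP.+-assoc (g zero) (sumFin (g ∘ suc)) (- g (suc p))))

sum≡0⇒zeros : ∀ {N} (a : Vec ℕ N) → Vec.sum a ≡ 0 → a ≡ Vec.replicate _ 0
sum≡0⇒zeros [] e = refl
sum≡0⇒zeros (zero ∷ a) e = cong (0 ∷_) (sum≡0⇒zeros a e)

sum-zeros : ∀ {N} → Vec.sum (Vec.replicate N 0) ≡ 0
sum-zeros {zero} = refl
sum-zeros {suc N} = sum-zeros {N}

𝒜-zeros : ∀ {N} → 𝒜 (Vec.replicate N 0) ≡ 1ℤ
𝒜-zeros {N} = trans (boxSum-zeros {N} (λ k → factℤ (Vec.sum k) * ∏signedS₂ (Vec.replicate _ 0) k))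
  (cong₂ (λ x y → factℤ x * y) (sum-zeros {N}) (trans (∏signedS₂-zeros (Vec.replicate N 0)) (cong δ₀ (sum-zeros {N}))))

𝒩-zeros : ∀ {N} (p : Fin N) → 𝒩 (Vec.replicate _ 0) p ≡ 1ℤ
𝒩-zeros {N} p = trans (cong (λ z → altBinomialSum z (λ d → 𝒜 (lowerAt (Vec.replicate N 0) p d))) (VP.lookup-replicate p 0))
  (trans (cong (λ z → 1ℤ * 1ℤ * 𝒜 z) (lowerAt-0 (Vec.replicate N 0) p)) (cong (λ z → 1ℤ * 1ℤ * z) (𝒜-zeros {N})))

sum1to-cong-pos : ∀ n {f g : ℕ → ℤ} → (∀ j → 1 ≤ j → j ≤ n → f j ≡ g j) → sum1to n f ≡ sum1to n g
sum1to-cong-pos zero    e = refl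
sum1to-cong-pos (suc n) e = cong₂ _+_ (sum1to-cong-pos n (λ j o j≤n → e j o (ℕP.m≤n⇒m≤1+n j≤n))) (e (suc n) (s≤s z≤n) ℕP.≤-refl)

m+n≤1+o⇒m≤o : ∀ m n o → 1 ≤ n → m ℕ.+ n ≤ suc o → m ≤ o
m+n≤1+o⇒m≤o m (suc n) o _ le rewrite ℕP.+-suc m n = ℕP.m+n≤o⇒m≤o m (ℕP.≤-pred le)

countRec≡𝒩 : ∀ {N} f (a : Vec ℕ N) p → Vec.sum a ≤ f → countRec f a p ≡ 𝒩 a p
countRec≡𝒩 zero a p le = trans (sym (𝒩-zeros p)) (cong (λ z → 𝒩 z p) (sym (sum≡0⇒zeros a (ℕP.n≤0⇒n≡0 le))))
countRec≡𝒩 (suc f) a p le with Vec.sum a in eq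
... | zero = trans (sym (𝒩-zeros p)) (cong (λ z → 𝒩 z p) (sym (sum≡0⇒zeros a eq)))
... | suc s = begin
  sumFin (λ q → if does (q ≟ p) then 0ℤ else S q)
    ≡⟨ sumFin-cong (λ q → cong (if_then_else_ (does (q ≟ p)) 0ℤ) (summand q)) ⟩
  sumFin (λ q → if does (q ≟ p) then 0ℤ else 𝒮 a q)
    ≡⟨ sumFin-except (𝒮 a) p ⟩
  sumFin (𝒮 a) - 𝒮 a p
    ≡⟨ cong₂ _-_ (sumFin-𝒮 a) (𝒮≡𝒜-𝒩 a p) ⟩
  (𝒜 a - δ₀ (Vec.sum a)) - (𝒜 a - 𝒩 a p)
    ≡⟨ cong (λ z → (𝒜 a - δ₀ z) - (𝒜 a - 𝒩 a p)) eq ⟩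
  (𝒜 a - 0ℤ) - (𝒜 a - 𝒩 a p)
    ≡⟨ difference (𝒜 a) (𝒩 a p) ⟩
  𝒩 a p ∎
  where
  open ≡-Reasoning
  difference : ∀ c x → (c - 0ℤ) - (c - x) ≡ x
  difference = solve-∀
  S = λ q → sum1to (lookup a q) (λ b → binomℤ (lookup a q) b * countRec f (lowerAt a q b) q)
  summand : ∀ q → S q ≡ 𝒮 a q
  summand q = begin
    sum1to A (λ b → binomℤ A b * countRec f (lowerAt a q b) q)
      ≡⟨ sum1to-cong-pos A (λ b 1≤b b≤A → cong (binomℤ A b *_)
           (trans (countRec≡𝒩 f (lowerAt a q b) q (m+n≤1+o⇒m≤o (Vec.sum (lowerAt a q b)) b f 1≤b
                     (subst (_≤ suc f) (sym (trans (sum-lowerAt a q b b≤A) eq)) le)))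
                  (𝒩-lowerAt b))) ⟩
    sum1to A (λ b → binomℤ A b * altBinomialSum (A ∸ b) (λ d → F (b ℕ.+ d)))
      ≡⟨ binomial-inversion-tail A F ⟩
    F 0 - 𝒩 a q
      ≡⟨ cong (λ z → 𝒜 z - 𝒩 a q) (lowerAt-0 a q) ⟩
    𝒜 a - 𝒩 a q
      ≡⟨ sym (𝒮≡𝒜-𝒩 a q) ⟩
    𝒮 a q ∎
    where
    A = lookup a q
    F = λ e → 𝒜 (lowerAt a q e)
    𝒩-lowerAt : ∀ b → 𝒩 (lowerAt a q b) q ≡ altBinomialSum (A ∸ b) (λ d → F (b ℕ.+ d))
    𝒩-lowerAt b = trans (cong (λ z → altBinomialSum z (λ d → 𝒜 (lowerAt (lowerAt a q b) q d))) (VP.lookup∘update q a (A ∸ b)))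
                 (altBinomialSum-cong (A ∸ b) (λ d _ → cong 𝒜 (lowerAt-lowerAt a q b d)))

-- At k = 0 the factor (0 ∸ 1)! is junk, but then ∏signedS₂ n k = 0 unless n = 0.
𝒰 : ∀ {N} → Vec ℕ N → ℤ
𝒰 n = boxSum n (λ k → factℤ (Vec.sum k ∸ 1) * ∏signedS₂ n k)

𝒩≡𝒰 : ∀ {N} (a : Vec ℕ N) p → 𝒩 a p ≡ 𝒰 (a [ p ]≔ suc (lookup a p))
𝒩≡𝒰 a p = begin
  sum0to A (λ d → binomℤ A d * -1^ d * 𝒜 (lowerAt a p d))
    ≡⟨ sum0to-cong A (λ d _ → trans (cong (binomℤ A d * -1^ d *_) (𝒜-lowerAt a p d)) (sym (boxSum-* a (binomℤ A d * -1^ d) (W d)))) ⟩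
  sum0to A (λ d → boxSum a (λ k → binomℤ A d * -1^ d * W d k))
    ≡⟨ sym (boxSum-sum0to a A (λ d k → binomℤ A d * -1^ d * W d k)) ⟩
  boxSum a (λ k → sum0to A (λ d → binomℤ A d * -1^ d * W d k))
    ≡⟨ boxSum-cong a term ⟩
  boxSum a H
    ≡⟨ cong (λ z → boxSum z H) (sym (VP.[]≔-lookup a p)) ⟩
  boxSum (a [ p ]≔ A) H
    ≡⟨ boxSum-extend a p A (suc A) H (ℕP.n≤1+n A) (λ k lt → trans (cong (λ z → factℤ (Vec.sum k) * z) (trans (cong (_* ∏signedS₂-except a k p) (signedS₂-≡0 (suc A) (suc (lookup k p)) (s≤s lt))) (ℤP.*-zeroˡ (∏signedS₂-except a k p)))) (ℤP.*-zeroʳ (factℤ (Vec.sum k)))) ⟩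
  boxSum n H
    ≡⟨ boxSum-cong n (λ k → sym (term-shifted k)) ⟩
  boxSum n (λ k → G (k [ p ]≔ suc (lookup k p)))
    ≡⟨ sym (boxSum-shift n p G vanishes-at-0 vanishes-above) ⟩
  boxSum n G
    ≡⟨ boxSum-cong n (λ k → cong (factℤ (Vec.sum k ∸ 1) *_) (sym (∏signedS₂-update a k p (suc A)))) ⟩
  𝒰 n ∎
  where
  open ≡-Reasoning
  A = lookup a p
  n = a [ p ]≔ suc A
  W = λ d k → factℤ (Vec.sum k) * signedS₂ (A ∸ d) (lookup k p) * ∏signedS₂-except a k p
  H = λ k → factℤ (Vec.sum k) * (signedS₂ (suc A) (suc (lookup k p)) * ∏signedS₂-except a k p)
  G = λ k → factℤ (Vec.sum k ∸ 1) * (signedS₂ (suc A) (lookup k p) * ∏signedS₂-except a k p)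
  regroup : ∀ b σ f c q → b * σ * (f * c * q) ≡ f * q * (b * σ * c)
  regroup = solve-∀
  swap-last : ∀ f q s → f * q * s ≡ f * (s * q)
  swap-last = solve-∀
  term : ∀ k → sum0to A (λ d → binomℤ A d * -1^ d * W d k) ≡ H k
  term k = trans (sum0to-cong A (λ d _ → regroup (binomℤ A d) (-1^ d) (factℤ (Vec.sum k)) (signedS₂ (A ∸ d) (lookup k p)) (∏signedS₂-except a k p)))
         (trans (sum0to-* A (factℤ (Vec.sum k) * ∏signedS₂-except a k p) (λ d → binomℤ A d * -1^ d * signedS₂ (A ∸ d) (lookup k p)))
         (trans (cong (factℤ (Vec.sum k) * ∏signedS₂-except a k p *_) (signedS₂-suc-binomial A (lookup k p)))
           (swap-last (factℤ (Vec.sum k)) (∏signedS₂-except a k p) (signedS₂ (suc A) (suc (lookup k p))))))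
  term-shifted : ∀ k → G (k [ p ]≔ suc (lookup k p)) ≡ H k
  term-shifted k = trans (cong₂ (λ x y → factℤ (x ∸ 1) * (signedS₂ (suc A) y * ∏signedS₂-except a (k [ p ]≔ suc (lookup k p)) p))
                   (sum-increment k p) (VP.lookup∘update p k (suc (lookup k p))))
                (cong (λ z → factℤ (Vec.sum k) * (signedS₂ (suc A) (suc (lookup k p)) * z)) (∏signedS₂-except-updateᵏ a k p _))
  vanishes-at-0 : ∀ k → lookup k p ≡ 0 → G k ≡ 0ℤ
  vanishes-at-0 k e rewrite e = trans (cong (factℤ (Vec.sum k ∸ 1) *_) (trans (cong (_* ∏signedS₂-except a k p) (ℤP.*-zeroʳ (-1^ (suc A ℕ.+ 0)))) (ℤP.*-zeroˡ (∏signedS₂-except a k p))))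
                       (ℤP.*-zeroʳ (factℤ (Vec.sum k ∸ 1)))
  vanishes-above : ∀ k → lookup k p ≡ suc (lookup n p) → G k ≡ 0ℤ
  vanishes-above k e rewrite VP.lookup∘update p a (suc A) | e =
    trans (cong (factℤ (Vec.sum k ∸ 1) *_) (trans (cong (_* ∏signedS₂-except a k p) (signedS₂-≡0 (suc A) (suc (suc A)) (ℕP.n<1+n (suc A)))) (ℤP.*-zeroˡ (∏signedS₂-except a k p))))
          (ℤP.*-zeroʳ (factℤ (Vec.sum k ∸ 1)))

boxSum1 : ∀ {N} → Vec ℕ N → (Vec ℕ N → ℤ) → ℤ
boxSum1 [] F = F []
boxSum1 (x ∷ xs) F = sum1to x (λ j → boxSum1 xs (λ k → F (j ∷ k)))

_≥ᵥ_ : ∀ {N} → Vec ℕ N → Vec ℕ N → Set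
[] ≥ᵥ [] = ⊤
(x ∷ xs) ≥ᵥ (k ∷ ks) = k ≤ x × xs ≥ᵥ ks

Positive : ∀ {N} → Vec ℕ N → Set
Positive [] = ⊤
Positive (x ∷ xs) = 1 ≤ x × Positive xs

boxSum1-cong-≤ : ∀ {N} (v : Vec ℕ N) {F G : Vec ℕ N → ℤ} → (∀ k → v ≥ᵥ k → F k ≡ G k) → boxSum1 v F ≡ boxSum1 v G
boxSum1-cong-≤ [] e = e [] tt
boxSum1-cong-≤ (x ∷ v) e = sum1to-cong x (λ j j≤x → boxSum1-cong-≤ v (λ k le → e (j ∷ k) (j≤x , le)))

boxSum≡boxSum1 : ∀ {N} (v : Vec ℕ N) → Positive v → (X : Vec ℕ N → ℤ) →
  boxSum v (λ k → ∏signedS₂ v k * X k) ≡ boxSum1 v (λ k → ∏signedS₂ v k * X k)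
boxSum≡boxSum1 [] _ X = refl
boxSum≡boxSum1 (suc x ∷ v) (_ , pv) X = begin
  sum0to (suc x) g
    ≡⟨ sum0to≡head+sum1to (suc x) g ⟩
  g 0 + sum1to (suc x) g
    ≡⟨ cong (_+ sum1to (suc x) g) (boxSum-≡0 v (λ k → trans (cong (λ z → z * ∏signedS₂ v k * X (0 ∷ k)) (ℤP.*-zeroʳ (-1^ (suc x ℕ.+ 0))))
                                                  (trans (cong (_* X (0 ∷ k)) (ℤP.*-zeroˡ (∏signedS₂ v k))) (ℤP.*-zeroˡ (X (0 ∷ k)))))) ⟩
  0ℤ + sum1to (suc x) g
    ≡⟨ ℤP.+-identityˡ _ ⟩
  sum1to (suc x) g
    ≡⟨ sum1to-cong (suc x) (λ j _ → slice j) ⟩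
  boxSum1 (suc x ∷ v) (λ k → ∏signedS₂ (suc x ∷ v) k * X k) ∎
  where
  open ≡-Reasoning
  g = λ j → boxSum v (λ k → ∏signedS₂ (suc x ∷ v) (j ∷ k) * X (j ∷ k))
  swap-front : ∀ c p y → c * p * y ≡ p * (c * y)
  swap-front = solve-∀
  slice : ∀ j → g j ≡ boxSum1 v (λ k → ∏signedS₂ (suc x ∷ v) (j ∷ k) * X (j ∷ k))
  slice j = trans (boxSum-cong v (λ k → swap-front (signedS₂ (suc x) j) (∏signedS₂ v k) (X (j ∷ k))))
         (trans (boxSum≡boxSum1 v pv (λ k → signedS₂ (suc x) j * X (j ∷ k)))
                (boxSum1-cong-≤ v (λ k _ → sym (swap-front (signedS₂ (suc x) j) (∏signedS₂ v k) (X (j ∷ k))))))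

∏S₂ᵥ : ∀ {N} → Vec ℕ N → Vec ℕ N → ℕ
∏S₂ᵥ [] [] = 1
∏S₂ᵥ (x ∷ v) (j ∷ k) = S₂ x j ℕ.* ∏S₂ᵥ v k

∏signedS₂≡-1^*∏S₂ : ∀ {N} (v k : Vec ℕ N) → ∏signedS₂ v k ≡ -1^ (Vec.sum v ℕ.+ Vec.sum k) * + ∏S₂ᵥ v k
∏signedS₂≡-1^*∏S₂ [] [] = refl
∏signedS₂≡-1^*∏S₂ (x ∷ v) (j ∷ k) rewrite ∏signedS₂≡-1^*∏S₂ v k = begin
  -1^ (x ℕ.+ j) * + S₂ x j * (-1^ (Vec.sum v ℕ.+ Vec.sum k) * + ∏S₂ᵥ v k)
    ≡⟨ interchange (-1^ (x ℕ.+ j)) (+ S₂ x j) (-1^ (Vec.sum v ℕ.+ Vec.sum k)) (+ ∏S₂ᵥ v k) ⟩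
  -1^ (x ℕ.+ j) * -1^ (Vec.sum v ℕ.+ Vec.sum k) * (+ S₂ x j * + ∏S₂ᵥ v k)
    ≡⟨ cong₂ _*_ (sym (-1^-+ (x ℕ.+ j) (Vec.sum v ℕ.+ Vec.sum k))) (sym (ℤP.pos-* (S₂ x j) (∏S₂ᵥ v k))) ⟩
  -1^ ((x ℕ.+ j) ℕ.+ (Vec.sum v ℕ.+ Vec.sum k)) * + (S₂ x j ℕ.* ∏S₂ᵥ v k)
    ≡⟨ cong (λ z → -1^ z * + (S₂ x j ℕ.* ∏S₂ᵥ v k)) (interchangeℕ x j (Vec.sum v) (Vec.sum k)) ⟩
  -1^ ((x ℕ.+ Vec.sum v) ℕ.+ (j ℕ.+ Vec.sum k)) * + (S₂ x j ℕ.* ∏S₂ᵥ v k) ∎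
  where
  open ≡-Reasoning
  interchange : ∀ a b c d → a * b * (c * d) ≡ a * c * (b * d)
  interchange = solve-∀
  interchangeℕ : ∀ x j a b → (x ℕ.+ j) ℕ.+ (a ℕ.+ b) ≡ (x ℕ.+ a) ℕ.+ (j ℕ.+ b)
  interchangeℕ = NS.solve-∀

-1^-+≡-1^-∸ : ∀ a b → b ≤ a → -1^ (a ℕ.+ b) ≡ -1^ (a ∸ b)
-1^-+≡-1^-∸ a b b≤a = begin
  -1^ (a ℕ.+ b) ≡⟨ cong (λ z → -1^ (z ℕ.+ b)) (sym (ℕP.m∸n+n≡m b≤a)) ⟩
  -1^ ((a ∸ b) ℕ.+ b ℕ.+ b) ≡⟨ cong -1^ (ℕP.+-assoc (a ∸ b) b b) ⟩
  -1^ ((a ∸ b) ℕ.+ (b ℕ.+ b)) ≡⟨ -1^-+ (a ∸ b) (b ℕ.+ b) ⟩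
  -1^ (a ∸ b) * -1^ (b ℕ.+ b) ≡⟨ cong (-1^ (a ∸ b) *_) (trans (-1^-+ b b) (-1^-square b)) ⟩
  -1^ (a ∸ b) * 1ℤ ≡⟨ ℤP.*-identityʳ _ ⟩
  -1^ (a ∸ b) ∎
  where open ≡-Reasoning

≥ᵥ⇒sum-≤ : ∀ {N} (v k : Vec ℕ N) → v ≥ᵥ k → Vec.sum k ≤ Vec.sum v
≥ᵥ⇒sum-≤ [] [] _ = z≤n
≥ᵥ⇒sum-≤ (x ∷ v) (j ∷ k) (j≤x , le) = ℕP.+-mono-≤ j≤x (≥ᵥ⇒sum-≤ v k le)

∣lookup∣ₜ : ∀ {K} (v : Vec ℕ K) → ∣ lookup v ∣ₜ ≡ Vec.sum v
∣lookup∣ₜ [] = refl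
∣lookup∣ₜ (x ∷ v) = cong (x ℕ.+_) (∣lookup∣ₜ v)

∣∣ₜ-tabulate : ∀ {K} (ns : Fin K → ℕ) → ∣ ns ∣ₜ ≡ Vec.sum (tabulate ns)
∣∣ₜ-tabulate {zero} ns = refl
∣∣ₜ-tabulate {suc K} ns = cong (ns zero ℕ.+_) (∣∣ₜ-tabulate (ns ∘ suc))

∏S₂-lookup : ∀ {K} (ns : Fin K → ℕ) (v : Vec ℕ K) → ∏S₂ ns (lookup v) ≡ ∏S₂ᵥ (tabulate ns) v
∏S₂-lookup {zero} ns [] = refl
∏S₂-lookup {suc K} ns (x ∷ v) = cong (S₂ (ns zero) x ℕ.*_) (∏S₂-lookup (ns ∘ suc) v)

∣∣ₜ-cong : ∀ {K} (f g : Fin K → ℕ) → (∀ i → f i ≡ g i) → ∣ f ∣ₜ ≡ ∣ g ∣ₜ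
∣∣ₜ-cong {zero} f g e = refl
∣∣ₜ-cong {suc K} f g e = cong₂ ℕ._+_ (e zero) (∣∣ₜ-cong (f ∘ suc) (g ∘ suc) (e ∘ suc))

∏S₂-cong : ∀ {K} (ns f g : Fin K → ℕ) → (∀ i → f i ≡ g i) → ∏S₂ ns f ≡ ∏S₂ ns g
∏S₂-cong {zero} ns f g e = refl
∏S₂-cong {suc K} ns f g e = cong₂ ℕ._*_ (cong (S₂ (ns zero)) (e zero)) (∏S₂-cong (ns ∘ suc) (f ∘ suc) (g ∘ suc) (e ∘ suc))

boxSum1-cong : ∀ {N} (v : Vec ℕ N) {F G : Vec ℕ N → ℤ} → (∀ k → F k ≡ G k) → boxSum1 v F ≡ boxSum1 v G
boxSum1-cong v e = boxSum1-cong-≤ v (λ k _ → e k)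

sumBox≡boxSum1 : ∀ K (ns : Fin K → ℕ) (F : (Fin K → ℕ) → ℤ) → (∀ f g → (∀ i → f i ≡ g i) → F f ≡ F g) →
  sumBox K ns F ≡ boxSum1 (tabulate ns) (λ v → F (lookup v))
sumBox≡boxSum1 zero ns F respF = respF _ _ (λ ())
sumBox≡boxSum1 (suc K) ns F respF = sum1to-cong (ns zero) (λ j _ →
  trans (sumBox≡boxSum1 K (ns ∘ suc) (λ ks → F (consT j ks)) (λ f g e → respF _ _ (λ { zero → refl ; (suc i) → e i })))
        (boxSum1-cong (tabulate (ns ∘ suc)) (λ v → respF _ _ (λ { zero → refl ; (suc i) → refl }))))

Positive-tabulate : ∀ {K} (ns : Fin K → ℕ) → (∀ j → 1 ≤ ns j) → Positive (tabulate ns)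
Positive-tabulate {zero} ns h = tt
Positive-tabulate {suc K} ns h = h zero , Positive-tabulate (ns ∘ suc) (h ∘ suc)

𝒰≡formula : ∀ K n₁ (ns : Fin K → ℕ) → (∀ j → 1 ≤ ns j) → 𝒰 (suc n₁ ∷ tabulate ns) ≡ formula K n₁ ns
𝒰≡formula K n₁ ns pos = begin
  sum0to (suc n₁) (λ j → boxSum tv (λ k → factℤ (j ℕ.+ Vec.sum k ∸ 1) * (signedS₂ (suc n₁) j * ∏signedS₂ tv k)))
    ≡⟨ sum0to-cong (suc n₁) (λ j _ → boxSum-cong tv (λ k → reorder (factℤ (j ℕ.+ Vec.sum k ∸ 1)) (signedS₂ (suc n₁) j) (∏signedS₂ tv k))) ⟩
  sum0to (suc n₁) (λ j → boxSum tv (λ k → ∏signedS₂ tv k * (signedS₂ (suc n₁) j * factℤ (j ℕ.+ Vec.sum k ∸ 1))))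
    ≡⟨ sym (boxSum-sum0to tv (suc n₁) (λ j k → ∏signedS₂ tv k * (signedS₂ (suc n₁) j * factℤ (j ℕ.+ Vec.sum k ∸ 1)))) ⟩
  boxSum tv (λ k → sum0to (suc n₁) (λ j → ∏signedS₂ tv k * (signedS₂ (suc n₁) j * factℤ (j ℕ.+ Vec.sum k ∸ 1))))
    ≡⟨ boxSum-cong tv (λ k → trans (sum0to-* (suc n₁) (∏signedS₂ tv k) (λ j → signedS₂ (suc n₁) j * factℤ (j ℕ.+ Vec.sum k ∸ 1)))
                                 (cong (∏signedS₂ tv k *_) (stirlingSum-closed n₁ (Vec.sum k)))) ⟩
  boxSum tv (λ k → ∏signedS₂ tv k * + (Vec.sum k ℕ.^ n₁ ℕ.* Vec.sum k !))
    ≡⟨ boxSum≡boxSum1 tv (Positive-tabulate ns pos) (λ k → + (Vec.sum k ℕ.^ n₁ ℕ.* Vec.sum k !)) ⟩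
  boxSum1 tv (λ k → ∏signedS₂ tv k * + (Vec.sum k ℕ.^ n₁ ℕ.* Vec.sum k !))
    ≡⟨ boxSum1-cong-≤ tv term ⟩
  boxSum1 tv (λ v → F (lookup v))
    ≡⟨ sym (sumBox≡boxSum1 K ns F respF) ⟩
  formula K n₁ ns ∎
  where
  open ≡-Reasoning
  tv = tabulate ns
  F : (Fin K → ℕ) → ℤ
  F ks = (-1ℤ ℤ.^ (∣ ns ∣ₜ ∸ ∣ ks ∣ₜ)) ℤ.* + (∣ ks ∣ₜ ℕ.^ n₁ ℕ.* (∣ ks ∣ₜ !) ℕ.* ∏S₂ ns ks)
  respF : ∀ f g → (∀ i → f i ≡ g i) → F f ≡ F g
  respF f g e rewrite ∣∣ₜ-cong f g e | ∏S₂-cong ns f g e = refl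
  reorder : ∀ f c p → f * (c * p) ≡ p * (c * f)
  reorder = solve-∀
  term : ∀ k → tv ≥ᵥ k → ∏signedS₂ tv k * + (Vec.sum k ℕ.^ n₁ ℕ.* Vec.sum k !) ≡ F (lookup k)
  term k le rewrite ∣lookup∣ₜ k | ∣∣ₜ-tabulate ns | ∏S₂-lookup ns k | ∏signedS₂≡-1^*∏S₂ tv k =
    trans (reorder′ (-1^ (Vec.sum tv ℕ.+ Vec.sum k)) (+ ∏S₂ᵥ tv k) (+ (Vec.sum k ℕ.^ n₁ ℕ.* Vec.sum k !)))
      (cong₂ _*_ (-1^-+≡-1^-∸ (Vec.sum tv) (Vec.sum k) (≥ᵥ⇒sum-≤ tv k le))
                 (sym (ℤP.pos-* (Vec.sum k ℕ.^ n₁ ℕ.* Vec.sum k !) (∏S₂ᵥ tv k))))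
    where
    reorder′ : ∀ s p x → s * p * x ≡ s * (x * p)
    reorder′ = solve-∀

true≢false : true ≡ false → ⊥
true≢false ()

∧≡true⁻ˡ : ∀ {a b} → a ∧ b ≡ true → a ≡ true
∧≡true⁻ˡ {true} e = refl

∧≡true⁻ʳ : ∀ {a b} → a ∧ b ≡ true → b ≡ true
∧≡true⁻ʳ {true} e = e

∨≡true⁻ : ∀ {a b} → a ∨ b ≡ true → a ≡ true ⊎ b ≡ true
∨≡true⁻ {true} e = inj₁ refl
∨≡true⁻ {false} e = inj₂ e

∨≡true⁺ʳ : ∀ a {b} → b ≡ true → a ∨ b ≡ true
∨≡true⁺ʳ true e = refl
∨≡true⁺ʳ false e = e

not≡true⁻ : ∀ {a} → not a ≡ true → a ≡ false
not≡true⁻ {false} e = refl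

not≡false⁻ : ∀ {a} → not a ≡ false → a ≡ true
not≡false⁻ {true} e = refl

-- Subsets of a part, as Boolean functions on its index set

subsetsOf : ∀ k → (Fin k → Bool) → List (Fin k → Bool)
subsetsOf zero u = (λ ()) ∷ []
subsetsOf (suc k) u = if u zero then map (true ∷ᵇ_) (subsetsOf k (u ∘ suc)) ++ map (false ∷ᵇ_) (subsetsOf k (u ∘ suc))
                  else map (false ∷ᵇ_) (subsetsOf k (u ∘ suc))

nonemptySubsetsOf : ∀ k → (Fin k → Bool) → List (Fin k → Bool)
nonemptySubsetsOf zero u = []
nonemptySubsetsOf (suc k) u = if u zero then map (true ∷ᵇ_) (subsetsOf k (u ∘ suc)) ++ map (false ∷ᵇ_) (nonemptySubsetsOf k (u ∘ suc))
                    else map (false ∷ᵇ_) (nonemptySubsetsOf k (u ∘ suc))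

countTrue : ∀ k → (Fin k → Bool) → ℕ
countTrue zero f = 0
countTrue (suc k) f = (if f zero then 1 else 0) ℕ.+ countTrue k (f ∘ suc)

_⊆ᵇ_ : ∀ {k} → (Fin k → Bool) → (Fin k → Bool) → Set
g ⊆ᵇ u = ∀ i → g i ≡ true → u i ≡ true

∷ᵇ-⊆ᵇ : ∀ {k} b (u : Fin (suc k) → Bool) (g' : Fin k → Bool) → (b ≡ true → u zero ≡ true) → g' ⊆ᵇ (u ∘ suc) → (b ∷ᵇ g') ⊆ᵇ u
∷ᵇ-⊆ᵇ b u g' h0 h zero e = h0 e
∷ᵇ-⊆ᵇ b u g' h0 h (suc i) e = h i e

subsetsOf-⊆ᵇ : ∀ k u {g} → g ∈ subsetsOf k u → g ⊆ᵇ u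
subsetsOf-⊆ᵇ zero u (here refl) ()
subsetsOf-⊆ᵇ (suc k) u {g} mg with u zero in u0
... | true with ∈-++⁻ (map (true ∷ᵇ_) (subsetsOf k (u ∘ suc))) mg
...   | inj₁ m with ∈-map⁻ (true ∷ᵇ_) m
...     | g' , m' , refl = ∷ᵇ-⊆ᵇ true u g' (λ _ → u0) (subsetsOf-⊆ᵇ k (u ∘ suc) m')
subsetsOf-⊆ᵇ (suc k) u {g} mg | true | inj₂ m with ∈-map⁻ (false ∷ᵇ_) m
...     | g' , m' , refl = ∷ᵇ-⊆ᵇ false u g' (λ ()) (subsetsOf-⊆ᵇ k (u ∘ suc) m')
subsetsOf-⊆ᵇ (suc k) u {g} mg | false with ∈-map⁻ (false ∷ᵇ_) mg
...   | g' , m' , refl = ∷ᵇ-⊆ᵇ false u g' (λ ()) (subsetsOf-⊆ᵇ k (u ∘ suc) m')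

nonemptySubsetsOf-⊆ᵇ : ∀ k u {g} → g ∈ nonemptySubsetsOf k u → g ⊆ᵇ u × Σ (Fin k) (λ i → g i ≡ true)
nonemptySubsetsOf-⊆ᵇ (suc k) u {g} mg with u zero in u0
... | true with ∈-++⁻ (map (true ∷ᵇ_) (subsetsOf k (u ∘ suc))) mg
...   | inj₁ m with ∈-map⁻ (true ∷ᵇ_) m
...     | g' , m' , refl = ∷ᵇ-⊆ᵇ true u g' (λ _ → u0) (subsetsOf-⊆ᵇ k (u ∘ suc) m') , zero , refl
nonemptySubsetsOf-⊆ᵇ (suc k) u {g} mg | true | inj₂ m with ∈-map⁻ (false ∷ᵇ_) m
...     | g' , m' , refl with nonemptySubsetsOf-⊆ᵇ k (u ∘ suc) m'
...       | le , i , e = ∷ᵇ-⊆ᵇ false u g' (λ ()) le , suc i , e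
nonemptySubsetsOf-⊆ᵇ (suc k) u {g} mg | false with ∈-map⁻ (false ∷ᵇ_) mg
...   | g' , m' , refl with nonemptySubsetsOf-⊆ᵇ k (u ∘ suc) m'
...       | le , i , e = ∷ᵇ-⊆ᵇ false u g' (λ ()) le , suc i , e

map-∷ᵇ-distinct : ∀ {k} b (S : List (Fin k → Bool)) → AllPairs (λ g g' → ¬ g ≗ g') S →
  AllPairs (λ g g' → ¬ g ≗ g') (map (b ∷ᵇ_) S)
map-∷ᵇ-distinct b S d = AllPairsₚ.map⁺ (AP.map (λ ne e → ne (e ∘ suc)) d)

true∷ᵇ-false∷ᵇ-distinct : ∀ {k} (S S' : List (Fin k → Bool)) → All (λ x → All (λ y → ¬ x ≗ y) (map (false ∷ᵇ_) S')) (map (true ∷ᵇ_) S)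
true∷ᵇ-false∷ᵇ-distinct S S' = Allₚ.map⁺ (All.tabulate λ _ → Allₚ.map⁺ (All.tabulate λ _ e → true≢false (e zero)))

subsetsOf-distinct : ∀ k u → AllPairs (λ g g' → ¬ g ≗ g') (subsetsOf k u)
subsetsOf-distinct zero u = [] ∷ []
subsetsOf-distinct (suc k) u with u zero
... | true = AllPairsₚ.++⁺ (map-∷ᵇ-distinct true _ (subsetsOf-distinct k (u ∘ suc))) (map-∷ᵇ-distinct false _ (subsetsOf-distinct k (u ∘ suc)))
               (true∷ᵇ-false∷ᵇ-distinct _ _)
... | false = map-∷ᵇ-distinct false _ (subsetsOf-distinct k (u ∘ suc))

nonemptySubsetsOf-distinct : ∀ k u → AllPairs (λ g g' → ¬ g ≗ g') (nonemptySubsetsOf k u)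
nonemptySubsetsOf-distinct zero u = []
nonemptySubsetsOf-distinct (suc k) u with u zero
... | true = AllPairsₚ.++⁺ (map-∷ᵇ-distinct true _ (subsetsOf-distinct k (u ∘ suc))) (map-∷ᵇ-distinct false _ (nonemptySubsetsOf-distinct k (u ∘ suc)))
               (true∷ᵇ-false∷ᵇ-distinct _ _)
... | false = map-∷ᵇ-distinct false _ (nonemptySubsetsOf-distinct k (u ∘ suc))

map-∷ᵇ-complete : ∀ {k b} {g : Fin (suc k) → Bool} {S} → g zero ≡ b → Any (λ g' → (g ∘ suc) ≗ g') S →
  Any (λ g' → g ≗ g') (map (b ∷ᵇ_) S)
map-∷ᵇ-complete g0 a = Anyₚ.map⁺ (Any.map (λ e → λ { zero → g0 ; (suc i) → e i }) a)

subsetsOf-complete : ∀ k u g → g ⊆ᵇ u → Any (λ g' → g ≗ g') (subsetsOf k u)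
subsetsOf-complete zero u g le = here (λ ())
subsetsOf-complete (suc k) u g le with u zero in u0 | g zero in g0
... | true | true = Anyₚ.++⁺ˡ (map-∷ᵇ-complete g0 (
                      (subsetsOf-complete k (u ∘ suc) (g ∘ suc) (λ i → le (suc i)))))
... | true | false = Anyₚ.++⁺ʳ (map (true ∷ᵇ_) (subsetsOf k (u ∘ suc))) (map-∷ᵇ-complete g0 (
                      (subsetsOf-complete k (u ∘ suc) (g ∘ suc) (λ i → le (suc i)))))
... | false | true = ⊥-elim (f≢t (trans (sym u0) (le zero g0)))
  where
  f≢t : false ≡ true → ⊥
  f≢t ()
... | false | false = map-∷ᵇ-complete g0 (
                      (subsetsOf-complete k (u ∘ suc) (g ∘ suc) (λ i → le (suc i))))

nonemptySubsetsOf-complete : ∀ k u g → g ⊆ᵇ u → Σ (Fin k) (λ i → g i ≡ true) → Any (λ g' → g ≗ g') (nonemptySubsetsOf k u)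
nonemptySubsetsOf-complete (suc k) u g le (i , gi) with u zero in u0 | g zero in g0
... | true | true = Anyₚ.++⁺ˡ (map-∷ᵇ-complete g0 (
                      (subsetsOf-complete k (u ∘ suc) (g ∘ suc) (λ i → le (suc i)))))
... | false | true = ⊥-elim (f≢t (trans (sym u0) (le zero g0)))
  where
  f≢t : false ≡ true → ⊥
  f≢t ()
nonemptySubsetsOf-complete (suc k) u g le (zero , gi) | _ | false = ⊥-elim (f≢t (trans (sym g0) gi))
  where
  f≢t : false ≡ true → ⊥
  f≢t ()
nonemptySubsetsOf-complete (suc k) u g le (suc i , gi) | true | false =
  Anyₚ.++⁺ʳ (map (true ∷ᵇ_) (subsetsOf k (u ∘ suc))) (map-∷ᵇ-complete g0 (
                      (nonemptySubsetsOf-complete k (u ∘ suc) (g ∘ suc) (λ i → le (suc i)) (i , gi))))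
nonemptySubsetsOf-complete (suc k) u g le (suc i , gi) | false | false =
  map-∷ᵇ-complete g0 (
                      (nonemptySubsetsOf-complete k (u ∘ suc) (g ∘ suc) (λ i → le (suc i)) (i , gi)))

sumList : ∀ {A : Set} → List A → (A → ℤ) → ℤ
sumList [] F = 0ℤ
sumList (x ∷ xs) F = F x + sumList xs F

sumList-++ : ∀ {A : Set} (xs ys : List A) F → sumList (xs ++ ys) F ≡ sumList xs F + sumList ys F
sumList-++ [] ys F = sym (ℤP.+-identityˡ _)
sumList-++ (x ∷ xs) ys F rewrite sumList-++ xs ys F = sym (ℤP.+-assoc (F x) (sumList xs F) (sumList ys F))

sumList-map : ∀ {A B : Set} (f : A → B) (xs : List A) F → sumList (map f xs) F ≡ sumList xs (F ∘ f)
sumList-map f [] F = refl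
sumList-map f (x ∷ xs) F = cong (λ z → F (f x) + z) (sumList-map f xs F)

sumList-cong : ∀ {A : Set} (xs : List A) {F G : A → ℤ} → (∀ x → x ∈ xs → F x ≡ G x) → sumList xs F ≡ sumList xs G
sumList-cong [] h = refl
sumList-cong (x ∷ xs) h = cong₂ _+_ (h x (here refl)) (sumList-cong xs (λ y m → h y (there m)))

length-concatMap : ∀ {A B : Set} (f : A → List B) (xs : List A) → + length (concatMap f xs) ≡ sumList xs (λ x → + length (f x))
length-concatMap f [] = refl
length-concatMap f (x ∷ xs) rewrite LP.length-++ (f x) {concatMap f xs} = trans (ℤP.pos-+ (length (f x)) _) (cong (λ z → + length (f x) + z) (length-concatMap f xs))

subsetsOf-sum : ∀ k u (F : ℕ → ℤ) → sumList (subsetsOf k u) (λ g → F (countTrue k g)) ≡ sum0to (countTrue k u) (λ b → binomℤ (countTrue k u) b * F b)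
subsetsOf-sum zero u F = trans (ℤP.+-identityʳ (F 0)) (sym (ℤP.*-identityˡ (F 0)))
subsetsOf-sum (suc k) u F with u zero
... | true = begin
  sumList (map (true ∷ᵇ_) S ++ map (false ∷ᵇ_) S) (λ g → F (countTrue (suc k) g))
    ≡⟨ sumList-++ (map (true ∷ᵇ_) S) (map (false ∷ᵇ_) S) (λ g → F (countTrue (suc k) g)) ⟩
  sumList (map (true ∷ᵇ_) S) (λ g → F (countTrue (suc k) g)) + sumList (map (false ∷ᵇ_) S) (λ g → F (countTrue (suc k) g))
    ≡⟨ cong₂ _+_ (trans (sumList-map (true ∷ᵇ_) S (λ g → F (countTrue (suc k) g))) (subsetsOf-sum k (u ∘ suc) (F ∘ suc)))
                 (trans (sumList-map (false ∷ᵇ_) S (λ g → F (countTrue (suc k) g))) (subsetsOf-sum k (u ∘ suc) F)) ⟩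
  sum0to A (λ b → binomℤ A b * F (suc b)) + sum0to A (λ b → binomℤ A b * F b)
    ≡⟨ trans (ℤP.+-comm (sum0to A (λ b → binomℤ A b * F (suc b))) (sum0to A (λ b → binomℤ A b * F b))) (sym (sum0to-pascal A F)) ⟩
  sum0to (suc A) (λ b → binomℤ (suc A) b * F b) ∎
  where
  open ≡-Reasoning
  S = subsetsOf k (u ∘ suc)
  A = countTrue k (u ∘ suc)
... | false = trans (sumList-map (false ∷ᵇ_) (subsetsOf k (u ∘ suc)) (λ g → F (countTrue (suc k) g))) (subsetsOf-sum k (u ∘ suc) F)

nonemptySubsetsOf-sum : ∀ k u (F : ℕ → ℤ) → sumList (nonemptySubsetsOf k u) (λ g → F (countTrue k g)) ≡ sum1to (countTrue k u) (λ b → binomℤ (countTrue k u) b * F b)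
nonemptySubsetsOf-sum zero u F = refl
nonemptySubsetsOf-sum (suc k) u F with u zero
... | true = begin
  sumList (map (true ∷ᵇ_) S ++ map (false ∷ᵇ_) NS) (λ g → F (countTrue (suc k) g))
    ≡⟨ sumList-++ (map (true ∷ᵇ_) S) (map (false ∷ᵇ_) NS) (λ g → F (countTrue (suc k) g)) ⟩
  sumList (map (true ∷ᵇ_) S) (λ g → F (countTrue (suc k) g)) + sumList (map (false ∷ᵇ_) NS) (λ g → F (countTrue (suc k) g))
    ≡⟨ cong₂ _+_ (trans (sumList-map (true ∷ᵇ_) S (λ g → F (countTrue (suc k) g))) (subsetsOf-sum k (u ∘ suc) (F ∘ suc)))
                 (trans (sumList-map (false ∷ᵇ_) NS (λ g → F (countTrue (suc k) g))) (nonemptySubsetsOf-sum k (u ∘ suc) F)) ⟩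
  sum0to A (λ b → binomℤ A b * F (suc b)) + sum1to A (λ b → binomℤ A b * F b)
    ≡⟨ sum1to-pascal A F ⟨
  sum1to (suc A) (λ b → binomℤ (suc A) b * F b) ∎
  where
  open ≡-Reasoning
  S = subsetsOf k (u ∘ suc)
  NS = nonemptySubsetsOf k (u ∘ suc)
  A = countTrue k (u ∘ suc)
... | false = trans (sumList-map (false ∷ᵇ_) (nonemptySubsetsOf k (u ∘ suc)) (λ g → F (countTrue (suc k) g))) (nonemptySubsetsOf-sum k (u ∘ suc) F)

countTrue-cong : ∀ k {f g : Fin k → Bool} → (∀ i → f i ≡ g i) → countTrue k f ≡ countTrue k g
countTrue-cong zero e = refl
countTrue-cong (suc k) e = cong₂ (λ x y → (if x then 1 else 0) ℕ.+ y) (e zero) (countTrue-cong k (e ∘ suc))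

countTrue-mono : ∀ k (g u : Fin k → Bool) → g ⊆ᵇ u → countTrue k g ≤ countTrue k u
countTrue-mono zero g u le = z≤n
countTrue-mono (suc k) g u le with g zero in g0 | u zero in u0
... | true | true = s≤s (countTrue-mono k (g ∘ suc) (u ∘ suc) (le ∘ suc))
... | true | false = ⊥-elim (true≢false (trans (sym (le zero g0)) u0))
... | false | true = ℕP.m≤n⇒m≤1+n (countTrue-mono k (g ∘ suc) (u ∘ suc) (le ∘ suc))
... | false | false = countTrue-mono k (g ∘ suc) (u ∘ suc) (le ∘ suc)

countTrue-pos : ∀ k (g : Fin k → Bool) i → g i ≡ true → 1 ≤ countTrue k g
countTrue-pos (suc k) g zero e rewrite e = s≤s z≤n
countTrue-pos (suc k) g (suc i) e = ℕP.≤-trans (countTrue-pos k (g ∘ suc) i e) (ℕP.m≤n+m _ (if g zero then 1 else 0))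

countTrue-∖ : ∀ k (u g : Fin k → Bool) → g ⊆ᵇ u → countTrue k (λ i → u i ∧ not (g i)) ≡ countTrue k u ∸ countTrue k g
countTrue-∖ zero u g le = refl
countTrue-∖ (suc k) u g le with g zero in g0 | u zero in u0
... | true | true = countTrue-∖ k (u ∘ suc) (g ∘ suc) (le ∘ suc)
... | true | false = ⊥-elim (true≢false (trans (sym (le zero g0)) u0))
... | false | true = trans (cong suc (countTrue-∖ k (u ∘ suc) (g ∘ suc) (le ∘ suc)))
                         (sym (ℕP.+-∸-assoc 1 (countTrue-mono k (g ∘ suc) (u ∘ suc) (le ∘ suc))))
... | false | false = countTrue-∖ k (u ∘ suc) (g ∘ suc) (le ∘ suc)

countTrue≡0⁻ : ∀ k (f : Fin k → Bool) → countTrue k f ≡ 0 → ∀ i → f i ≡ false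
countTrue≡0⁻ (suc k) f e zero with f zero
... | false = refl
countTrue≡0⁻ (suc k) f e (suc i) with f zero
... | false = countTrue≡0⁻ k (f ∘ suc) e i

countTrue≡0⁺ : ∀ k (f : Fin k → Bool) → (∀ i → f i ≡ false) → countTrue k f ≡ 0
countTrue≡0⁺ zero f h = refl
countTrue≡0⁺ (suc k) f h rewrite h zero = countTrue≡0⁺ k (f ∘ suc) (h ∘ suc)

vec-ext : ∀ {N} {A : Set} (xs ys : Vec A N) → (∀ i → lookup xs i ≡ lookup ys i) → xs ≡ ys
vec-ext xs ys e = trans (sym (VP.tabulate∘lookup xs)) (trans (VP.tabulate-cong e) (VP.tabulate∘lookup ys))

sumList-tabulate : ∀ {A : Set} {n} (f : Fin n → A) (F : A → ℤ) → sumList (L.tabulate f) F ≡ sumFin (λ q → F (f q))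
sumList-tabulate {n = zero} f F = refl
sumList-tabulate {n = suc n} f F = cong (λ z → F (f zero) + z) (sumList-tabulate (f ∘ suc) F)

countTrue-all : ∀ k → countTrue k (λ _ → true) ≡ k
countTrue-all zero = refl
countTrue-all (suc k) = cong suc (countTrue-all k)

countTrue-single : ∀ k (f : Fin k → Bool) i0 → f i0 ≡ true → (∀ i → f i ≡ true → i ≡ i0) → countTrue k f ≡ 1
countTrue-single (suc k) f zero e u rewrite e = cong suc (countTrue≡0⁺ k (f ∘ suc) (λ i → rest-false i))
  where
  rest-false : ∀ i → f (suc i) ≡ false
  rest-false i with f (suc i) in fi
  ... | false = refl
  ... | true with u (suc i) fi
  ...   | ()
countTrue-single (suc k) f (suc j) e u with f zero in f0
... | true with u zero f0
...   | ()
countTrue-single (suc k) f (suc j) e u | false = countTrue-single k (f ∘ suc) j e (λ i fi → FP.suc-injective (u (suc i) fi))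

AllPairs-map-All : ∀ {A : Set} {R S : A → A → Set} {Q : A → Set} {xs : List A} →
  (∀ {x y} → Q x → Q y → R x y → S x y) → All Q xs → AllPairs R xs → AllPairs S xs
AllPairs-map-All f [] [] = []
AllPairs-map-All f (qx ∷ qxs) (rx ∷ rxs) = All.zipWith (λ (qy , r) → f qx qy r) (qxs , rx) ∷ AllPairs-map-All f qxs rxs

-- Acyclic orientations of complete multipartite graphs

module Orientations {N : ℕ} (m : Fin N → ℕ) where

  V : Set
  V = Vertex m

  Rel : Set
  Rel = Rel₂ m

  _≟V_ : (u v : V) → Dec (u ≡ v)
  _≟V_ = PP.≡-dec F._≟_ F._≟_

  allV : List V
  allV = concatMap (λ i → map (i ,_) (allFin (m i))) (allFin N)

  ∈-allV : ∀ v → v ∈ allV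
  ∈-allV (i , j) = Anyₚ.concatMap⁺ _ (Any.map (λ { refl → Anyₚ.map⁺ (Any.map (cong (i ,_)) (∈-allFin j)) }) (∈-allFin i))

  _≈_ : Rel → Rel → Set
  _≈_ = _≗₂_ {m = m}

  ≈-refl : ∀ {o} → o ≈ o
  ≈-refl u v = refl

  ≈-sym : ∀ {o o'} → o ≈ o' → o' ≈ o
  ≈-sym e u v = sym (e u v)

  ≈-trans : ∀ {o o' o''} → o ≈ o' → o' ≈ o'' → o ≈ o''
  ≈-trans e e' u v = trans (e u v) (e' u v)

  searchArc : (o : Rel) (u : V) (xs : List V) → (Σ V λ w → o u w ≡ true) ⊎ (∀ w → w ∈ xs → o u w ≡ false)
  searchArc o u [] = inj₂ (λ w ())
  searchArc o u (x ∷ xs) with o u x in eq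
  ... | true = inj₁ (x , eq)
  ... | false with searchArc o u xs
  ...   | inj₁ r = inj₁ r
  ...   | inj₂ r = inj₂ (λ { w (here refl) → eq ; w (there mw) → r w mw })

  findArc : (o : Rel) (u : V) → (Σ V λ w → o u w ≡ true) ⊎ IsSink {m = m} o u
  findArc o u with searchArc o u allV
  ... | inj₁ r = inj₁ r
  ... | inj₂ r = inj₂ (λ w a → case-tf (trans (sym a) (r w (∈-allV w))))
    where
    case-tf : true ≡ false → ⊥
    case-tf ()

  sinkᵇ : Rel → V → Bool
  sinkᵇ o u with findArc o u
  ... | inj₁ _ = false
  ... | inj₂ _ = true

  sinkᵇ-sound : ∀ o u → sinkᵇ o u ≡ true → IsSink {m = m} o u
  sinkᵇ-sound o u e with findArc o u
  ... | inj₂ s = s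

  sinkᵇ-complete : ∀ o u → IsSink {m = m} o u → sinkᵇ o u ≡ true
  sinkᵇ-complete o u s with findArc o u
  ... | inj₁ (w , a) = ⊥-elim (s w a)
  ... | inj₂ _ = refl

  ¬sinkᵇ⇒arc : ∀ o u → sinkᵇ o u ≡ false → Σ V λ w → o u w ≡ true
  ¬sinkᵇ⇒arc o u e with findArc o u
  ... | inj₁ r = r

  IsSink-resp : ∀ {o o'} → o ≈ o' → ∀ u → IsSink {m = m} o u → IsSink {m = m} o' u
  IsSink-resp e u s w a = s w (trans (e u w) a)

  sinkᵇ-resp : ∀ {o o'} → o ≈ o' → ∀ u → sinkᵇ o u ≡ sinkᵇ o' u
  sinkᵇ-resp {o} {o'} e u with sinkᵇ o u in e1 | sinkᵇ o' u in e2
  ... | true | true = refl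
  ... | false | false = refl
  ... | true | false = let (w , a) = ¬sinkᵇ⇒arc o' u e2 in ⊥-elim (sinkᵇ-sound o u e1 w (trans (e u w) a))
  ... | false | true = let (w , a) = ¬sinkᵇ⇒arc o u e1 in ⊥-elim (sinkᵇ-sound o' u e2 w (trans (sym (e u w)) a))

  Enumerates-⇔ : ∀ {P Q : Rel → Set} {Ls} → (∀ o → P o → Q o) → (∀ o → Q o → P o) → Enumerates {m = m} P Ls → Enumerates {m = m} Q Ls
  Enumerates-⇔ pq qp (d , a , c) = d , All.map (pq _) a , (λ o q → c o (qp o q))

  Enumerates-single : ∀ {P : Rel → Set} c → (∀ o → P o → o ≈ c) → P c → Enumerates {m = m} P [ c ]
  Enumerates-single c h pc = ([] ∷ []) , (pc ∷ []) , (λ o p → here (h o p))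

  Enumerates-map : ∀ {Q : Rel → Set} {Ls} (f : Rel → Rel) → (∀ x y → x ≈ y → f x ≈ f y) →
    (∀ x y → Q x → Q y → f x ≈ f y → x ≈ y) → Enumerates {m = m} Q Ls →
    Enumerates {m = m} (λ o → Σ Rel λ x → Q x × o ≈ f x) (map f Ls)
  Enumerates-map f fr inj (d , a , c) =
    AllPairsₚ.map⁺ (AllPairs-map-All (λ {x} {y} qx qy ne e → ne (inj x y qx qy e)) a d) ,
    Allₚ.map⁺ (All.map (λ {x} q → x , q , ≈-refl) a) ,
    (λ o (x , q , e) → Anyₚ.map⁺ (Any.map (λ {y} e' → ≈-trans e (fr x y e')) (c x q)))

  Enumerates-concatMap : ∀ {X : Set} (xs : List X) (Ls : X → List Rel) (Ps : X → Rel → Set) →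
    (∀ x → x ∈ xs → Enumerates {m = m} (Ps x) (Ls x)) →
    AllPairs (λ x y → ∀ a b → Ps x a → Ps y b → ¬ a ≈ b) xs →
    Enumerates {m = m} (λ o → Any (λ x → Ps x o) xs) (concatMap Ls xs)
  Enumerates-concatMap xs Ls Ps en dis =
    AllPairsₚ.concat⁺ (Allₚ.map⁺ (All.tabulate (λ {x} mx → proj₁ (en x mx))))
      (AllPairsₚ.map⁺ (AllPairs-map-All cross (All.tabulate (λ mx → mx)) dis)) ,
    Allₚ.concat⁺ (Allₚ.map⁺ (All.tabulate (λ {x} mx → All.map (λ pa → Any.map (λ { refl → pa }) mx) (sound x mx)))) ,
    (λ o an → let (x , mx , p) = find an in Anyₚ.concatMap⁺ Ls (Any.map (λ { refl → proj₂ (proj₂ (en x mx)) o p }) mx))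
    where
    sound : ∀ x → x ∈ xs → All (Ps x) (Ls x)
    sound x mx = proj₁ (proj₂ (en x mx))
    cross : ∀ {x y} → x ∈ xs → y ∈ xs → (∀ a b → Ps x a → Ps y b → ¬ a ≈ b) →
      All (λ a → All (λ b → ¬ a ≈ b) (Ls y)) (Ls x)
    cross {x} {y} mx my r = All.tabulate λ {a} ma → All.tabulate λ {b} mb →
      r a b (All.lookup (sound x mx) ma) (All.lookup (sound y my) mb)

  VSet : Set
  VSet = V → Bool

  _∖_ : VSet → VSet → VSet
  (U ∖ B) v = U v ∧ not (B v)

  ArcsWithin : VSet → Rel → Set
  ArcsWithin U o = ∀ u v → o u v ≡ true → U u ≡ true × U v ≡ true

  OrientsOn : VSet → Rel → Set
  OrientsOn U o = ∀ u v → U u ≡ true → U v ≡ true →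
    (proj₁ u ≡ proj₁ v → o u v ≡ false) × (¬ proj₁ u ≡ proj₁ v → o u v ≡ not (o v u))

  AcyclicOn : VSet → Rel → Set
  AcyclicOn U o = ArcsWithin U o × OrientsOn U o × IsAcyclic {m = m} o

  NoSinkIn : VSet → Fin N → Rel → Set
  NoSinkIn U p o = AcyclicOn U o × (∀ u → U u ≡ true → IsSink {m = m} o u → ¬ proj₁ u ≡ p)

  module ArcFacts {U : VSet} {o : Rel} (arcs : ArcsWithin U o) (or : OrientsOn U o) where
    arc-part : ∀ {u v} → o u v ≡ true → ¬ proj₁ u ≡ proj₁ v
    arc-part {u} {v} a e with arcs u v a
    ... | uu , uv = true≢false (trans (sym a) (proj₁ (or u v uu uv) e))

    arc-neq : ∀ {u v} → o u v ≡ true → ¬ u ≡ v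
    arc-neq a e = arc-part a (cong proj₁ e)

    antisym : ∀ {u v} → o u v ≡ true → o v u ≡ true → ⊥
    antisym {u} {v} a b with arcs u v a
    ... | uu , uv = true≢false (trans (sym a) (trans (proj₂ (or u v uu uv) (arc-part a)) (cong not b)))

    orient-or : ∀ u v → U u ≡ true → U v ≡ true → ¬ proj₁ u ≡ proj₁ v → o u v ≡ true ⊎ o v u ≡ true
    orient-or u v uu uv ne with o v u in e
    ... | true = inj₂ refl
    ... | false = inj₁ (trans (proj₂ (or u v uu uv) ne) (cong not e))

    cyc3 : ∀ {u v x} → o u v ≡ true → o v x ≡ true → o x u ≡ true → DirectedCycle {m = m} o
    cyc3 {u} {v} {x} a1 a2 a3 = u , v ∷ x ∷ [] , (a1 ∷ a2 ∷ a3 ∷ [-]) ,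
      ((arc-neq a1 ∷ (λ e → arc-neq a3 (sym e)) ∷ []) ∷ (arc-neq a2 ∷ []) ∷ [] ∷ [])

    cyc4 : ∀ {u v x w} → o u v ≡ true → o v x ≡ true → o x w ≡ true → o w u ≡ true →
      ¬ u ≡ x → ¬ v ≡ w → DirectedCycle {m = m} o
    cyc4 {u} {v} {x} {w} a1 a2 a3 a4 ux vw = u , v ∷ x ∷ w ∷ [] , (a1 ∷ a2 ∷ a3 ∷ a4 ∷ [-]) ,
      ((arc-neq a1 ∷ ux ∷ (λ e → arc-neq a4 (sym e)) ∷ []) ∷ (arc-neq a2 ∷ vw ∷ []) ∷ (arc-neq a3 ∷ []) ∷ [] ∷ [])

  countL : (V → Bool) → List V → ℕ
  countL P [] = 0
  countL P (x ∷ xs) = (if P x then 1 else 0) ℕ.+ countL P xs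

  countL-mono : ∀ (P Q : V → Bool) xs → (∀ w → P w ≡ true → Q w ≡ true) → countL P xs ≤ countL Q xs
  countL-mono P Q [] h = z≤n
  countL-mono P Q (x ∷ xs) h with P x in px | Q x in qx
  ... | true | true = s≤s (countL-mono P Q xs h)
  ... | true | false = ⊥-elim (true≢false (trans (sym (h x px)) qx))
  ... | false | true = ℕP.m≤n⇒m≤1+n (countL-mono P Q xs h)
  ... | false | false = countL-mono P Q xs h

  countL-strict : ∀ (P Q : V → Bool) xs {x} → (∀ w → P w ≡ true → Q w ≡ true) → x ∈ xs → Q x ≡ true → P x ≡ false →
    countL P xs < countL Q xs
  countL-strict P Q (y ∷ xs) h (here refl) qx px rewrite qx | px = s≤s (countL-mono P Q xs h)
  countL-strict P Q (y ∷ xs) h (there mx) qx px with P y in py | Q y in qy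
  ... | true | true = s≤s (countL-strict P Q xs h mx qx px)
  ... | true | false = ⊥-elim (true≢false (trans (sym (h y py)) qy))
  ... | false | true = ℕP.m≤n⇒m≤1+n (countL-strict P Q xs h mx qx px)
  ... | false | false = countL-strict P Q xs h mx qx px

  anyL : (V → Bool) → List V → Bool
  anyL f [] = false
  anyL f (x ∷ xs) = f x ∨ anyL f xs

  anyL-intro : ∀ f xs {x} → x ∈ xs → f x ≡ true → anyL f xs ≡ true
  anyL-intro f (y ∷ xs) (here refl) e rewrite e = refl
  anyL-intro f (y ∷ xs) (there mx) e = ∨≡true⁺ʳ (f y) (anyL-intro f xs mx e)

  anyL-elim : ∀ f xs → anyL f xs ≡ true → Σ V λ x → f x ≡ true
  anyL-elim f (y ∷ xs) e with ∨≡true⁻ {f y} e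
  ... | inj₁ e' = y , e'
  ... | inj₂ e' = anyL-elim f xs e'

  anyL-false : ∀ f xs → (∀ x → f x ≡ false) → anyL f xs ≡ false
  anyL-false f [] h = refl
  anyL-false f (y ∷ xs) h rewrite h y = anyL-false f xs h

  -- Following arcs reaches a sink: along an arc u → v the set of vertices reachable in at most
  -- two steps strictly shrinks, since otherwise the multipartite structure yields a 3- or 4-cycle.
  reach≤2 : Rel → V → V → Bool
  reach≤2 o u w = o u w ∨ anyL (λ x → o u x ∧ o x w) allV

  ∣reach≤2∣ : Rel → V → ℕ
  ∣reach≤2∣ o u = countL (reach≤2 o u) allV

  module SinkExistence {U : VSet} {o : Rel} (arcs : ArcsWithin U o) (or : OrientsOn U o) (ac : IsAcyclic {m = m} o) where
    open ArcFacts arcs or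

    reach≤2-via : ∀ {u x w} → o u x ≡ true → o x w ≡ true → reach≤2 o u w ≡ true
    reach≤2-via {u} {x} {w} a b = ∨≡true⁺ʳ (o u w) (anyL-intro (λ y → o u y ∧ o y w) allV (∈-allV x) (subst (λ z → z ∧ o x w ≡ true) (sym a) b))

    reach≤2-shrinks : ∀ {u v} → o u v ≡ true → ∀ w → reach≤2 o v w ≡ true → reach≤2 o u w ≡ true
    reach≤2-shrinks {u} {v} a w d with ∨≡true⁻ {o v w} d
    ... | inj₁ b = reach≤2-via a b
    ... | inj₂ an with anyL-elim (λ y → o v y ∧ o y w) allV an
    ...   | x , vxw with ∧≡true⁻ˡ {o v x} vxw | ∧≡true⁻ʳ {o v x} vxw
    ...     | vx | xw with proj₁ u F.≟ proj₁ x
    ...       | no ne with orient-or u x (proj₁ (arcs u v a)) (proj₁ (arcs x w xw)) ne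
    ...         | inj₁ ux = reach≤2-via ux xw
    ...         | inj₂ xu = ⊥-elim (ac (cyc3 a vx xu))
    reach≤2-shrinks {u} {v} a w d | inj₂ an | x , vxw | vx | xw | yes eq
      with orient-or u w (proj₁ (arcs u v a)) (proj₂ (arcs x w xw)) (λ e → arc-part xw (trans (sym eq) e))
    ... | inj₁ uw = ∨-r' uw
      where
      ∨-r' : o u w ≡ true → reach≤2 o u w ≡ true
      ∨-r' e rewrite e = refl
    ... | inj₂ wu = ⊥-elim (ac (cyc4 a vx xw wu (λ e → antisym a (subst (λ z → o v z ≡ true) (sym e) vx))
                                             (λ e → antisym vx (subst (λ z → o x z ≡ true) (sym e) xw))))

    reach≤2-irrefl : ∀ v → reach≤2 o v v ≡ false
    reach≤2-irrefl v with o v v in e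
    ... | true = ⊥-elim (arc-neq e refl)
    ... | false = anyL-false (λ y → o v y ∧ o y v) allV (λ y → no-2-cycle y)
      where
      no-2-cycle : ∀ y → o v y ∧ o y v ≡ false
      no-2-cycle y with o v y in e1 | o y v in e2
      ... | true | true = ⊥-elim (antisym e1 e2)
      ... | true | false = refl
      ... | false | _ = refl

    ∣reach≤2∣-decreases : ∀ {u v} → o u v ≡ true → ∣reach≤2∣ o v < ∣reach≤2∣ o u
    ∣reach≤2∣-decreases {u} {v} a = countL-strict (reach≤2 o v) (reach≤2 o u) allV (reach≤2-shrinks a) (∈-allV v) (arc⇒reach≤2 a) (reach≤2-irrefl v)
      where
      arc⇒reach≤2 : o u v ≡ true → reach≤2 o u v ≡ true
      arc⇒reach≤2 e rewrite e = refl

    findSink : ∀ fuel u → U u ≡ true → ∣reach≤2∣ o u < fuel → Σ V λ s → U s ≡ true × IsSink {m = m} o s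
    findSink (suc fuel) u uu lt with findArc o u
    ... | inj₂ s = u , uu , s
    ... | inj₁ (w , a) = findSink fuel w (proj₂ (arcs u w a)) (ℕP.<-≤-trans (∣reach≤2∣-decreases a) (ℕP.≤-pred lt))

    sinkExists : ∀ u → U u ≡ true → Σ V λ s → U s ≡ true × IsSink {m = m} o s
    sinkExists u uu = findSink (suc (∣reach≤2∣ o u)) u uu ℕP.≤-refl

  notinB : ∀ {U B : VSet} v → B v ≡ true → (U ∖ B) v ≡ false
  notinB {U} v bv rewrite bv = BoolP.∧-zeroʳ (U v)

  inB : ∀ {U B : VSet} v → U v ≡ true → B v ≡ false → (U ∖ B) v ≡ true
  inB v uv bv rewrite uv | bv = refl

  module Chains {R R' : V → V → Set} {Q : V → Set} (f : ∀ {x y} → R x y → Q y → R' x y) (g : ∀ {x y} → R x y → Q x) where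
    source-ok : ∀ x (zs : List V) v → Linked R (x ∷ zs ++ v ∷ []) → Q x
    source-ok x [] v (r ∷ _) = g r
    source-ok x (z ∷ zs) v (r ∷ _) = g r

    transfer : ∀ (xs : List V) v → Q v → Linked R (xs ++ v ∷ []) → Linked R' (xs ++ v ∷ [])
    transfer [] v qv [-] = [-]
    transfer (x ∷ []) v qv (r ∷ [-]) = f r qv ∷ [-]
    transfer (x ∷ y ∷ xs) v qv (r ∷ rest) = f r (source-ok y xs v rest) ∷ transfer (y ∷ xs) v qv rest

  -- On a directed cycle the head of every arc has an outgoing arc.
  IsAcyclic-conv : ∀ {o o' : Rel} → (∀ {x y} → o x y ≡ true → (Σ V λ w → o y w ≡ true) → o' x y ≡ true) →
    IsAcyclic {m = m} o' → IsAcyclic {m = m} o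
  IsAcyclic-conv {o} {o'} f ac (v , l , lk , un) =
    ac (v , l , Chains.transfer {R = λ x y → o x y ≡ true} {R' = λ x y → o' x y ≡ true} f (λ {x} {y} r → y , r) (v ∷ l) v
                  (Chains.source-ok {R = λ x y → o x y ≡ true} {R' = λ x y → o' x y ≡ true} f (λ {x} {y} r → y , r) v l v lk) lk , un)

  IsAcyclic-mono : ∀ {o o' : Rel} → (∀ x y → o x y ≡ true → o' x y ≡ true) → IsAcyclic {m = m} o' → IsAcyclic {m = m} o
  IsAcyclic-mono h ac (v , l , lk , un) = ac (v , l , Lk.map (λ {x} {y} → h x y) lk , un)

  -- Extends o, given on U ∖ B, by turning B ⊆ part q into sinks: every vertex of U outside B
  -- and outside part q gets an arc into each vertex of B.
  addSinks : VSet → Fin N → VSet → Rel → Rel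
  addSinks U q B o u v = if B v then (U u ∧ (not (B u) ∧ not (does (proj₁ u F.≟ q)))) else o u v

  deleteArcsInto : VSet → Rel → Rel
  deleteArcsInto B o u v = if B v then false else o u v

  module AddSinks {U : VSet} {q : Fin N} {B : VSet} {o : Rel}
             (BU : ∀ v → B v ≡ true → U v ≡ true) (Bq : ∀ v → B v ≡ true → proj₁ v ≡ q)
             (base : AcyclicOn (U ∖ B) o) where
    arcs = proj₁ base
    or = proj₁ (proj₂ base)
    ac = proj₂ (proj₂ base)
    e = addSinks U q B o

    B-noOut : ∀ v → B v ≡ true → ∀ w → e v w ≡ true → ⊥
    B-noOut v bv w a with B w in bw
    ... | true rewrite bv = true≢false (trans (sym a) (BoolP.∧-zeroʳ (U v)))
    ... | false with arcs v w a
    ...   | uv , _ rewrite bv = true≢false (trans (sym uv) (BoolP.∧-zeroʳ (U v)))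

    arcsWithin : ArcsWithin U e
    arcsWithin u v a with B v in bv
    ... | true = ∧≡true⁻ˡ {U u} a , BU v bv
    ... | false = ∧≡true⁻ˡ {U u} (proj₁ (arcs u v a)) , ∧≡true⁻ˡ {U v} (proj₂ (arcs u v a))

    orientsOn : OrientsOn U e
    orientsOn u v uu uv = same , diff
      where
      same : proj₁ u ≡ proj₁ v → e u v ≡ false
      same eq with B v in bv
      ... | true rewrite dec-true (proj₁ u F.≟ q) (trans eq (Bq v bv)) | BoolP.∧-zeroʳ (not (B u)) = BoolP.∧-zeroʳ (U u)
      ... | false with o u v in a
      ...   | false = refl
      ...   | true = ⊥-elim (true≢false (trans (sym a) (proj₁ (or u v (proj₁ (arcs u v a)) (proj₂ (arcs u v a))) eq)))
      diff : ¬ proj₁ u ≡ proj₁ v → e u v ≡ not (e v u)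
      diff ne with B u in bu | B v in bv
      ... | true | true = ⊥-elim (ne (trans (Bq u bu) (sym (Bq v bv))))
      ... | false | true rewrite uu | dec-false (proj₁ u F.≟ q) (λ eq → ne (trans eq (sym (Bq v bv)))) with o v u in a
      ...   | false = refl
      ...   | true = ⊥-elim (true≢false (trans (sym (proj₁ (arcs v u a))) (notinB {U} {B} v bv)))
      diff ne | true | false rewrite uv | dec-false (proj₁ v F.≟ q) (λ eq → ne (trans (Bq u bu) (sym eq))) with o u v in a
      ...   | false = refl
      ...   | true = ⊥-elim (true≢false (trans (sym (proj₁ (arcs u v a))) (notinB {U} {B} u bu)))
      diff ne | false | false =
        proj₂ (or u v (inB {U} {B} u uu bu) (inB {U} {B} v uv bv)) ne

    acyclic : IsAcyclic {m = m} e
    acyclic = IsAcyclic-conv arc-kept ac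
      where
      arc-kept : ∀ {x y} → e x y ≡ true → (Σ V λ w → e y w ≡ true) → o x y ≡ true
      arc-kept {x} {y} a (w , b) = subst (λ z → (if z then (U x ∧ (not (B x) ∧ not (does (proj₁ x F.≟ q)))) else o x y) ≡ true) y∉B a
        where
        y∉B : B y ≡ false
        y∉B = BoolP.¬-not (λ by → B-noOut y by w b)

    acyclicOn : AcyclicOn U e
    acyclicOn = arcsWithin , orientsOn , acyclic

    module Sinks (ne : Σ V λ b → B b ≡ true) (sc : ∀ u → (U ∖ B) u ≡ true → IsSink {m = m} o u → ¬ proj₁ u ≡ q) where
      outArc : ∀ v → U v ≡ true → B v ≡ false → Σ V λ w → e v w ≡ true
      outArc v uv bv = byPart (proj₁ v F.≟ q)
        where
        byPart : Dec (proj₁ v ≡ q) → Σ V λ w → e v w ≡ true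
        byPart (no nq) = proj₁ ne , arc
          where
          arc : e v (proj₁ ne) ≡ true
          arc rewrite proj₂ ne | uv | bv | dec-false (proj₁ v F.≟ q) nq = refl
        byPart (yes eq) with findArc o v
        ... | inj₂ s = ⊥-elim (sc v (inB {U} {B} v uv bv) s eq)
        ... | inj₁ (w , a) = w , arc
          where
          w∉B : B w ≡ false
          w∉B = BoolP.¬-not (λ bw′ → true≢false (trans (sym (proj₂ (arcs v w a))) (notinB {U} {B} w bw′)))
          arc : e v w ≡ true
          arc rewrite w∉B = a

      sinks≡B : ∀ v → U v ∧ sinkᵇ e v ≡ B v
      sinks≡B v with B v in bv
      ... | true rewrite BU v bv = sinkᵇ-complete e v (λ w a → B-noOut v bv w a)
      ... | false with U v in uv
      ...   | false = refl
      ...   | true with sinkᵇ e v in sb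
      ...     | false = refl
      ...     | true = let (w , a) = outArc v uv bv in ⊥-elim (sinkᵇ-sound e v sb w a)

      noSinkIn : ∀ p → ¬ q ≡ p → NoSinkIn U p e
      noSinkIn p qp = acyclicOn , (λ u uu s eq → qp (trans (sym (Bq u (trans (sym (sinks≡B u)) (trans (cong (_∧ sinkᵇ e u) uu) (sinkᵇ-complete e u s))))) eq))

  module RemoveSinks {U : VSet} {q : Fin N} {B : VSet} {o : Rel}
             (base : AcyclicOn U o) (Bdef : ∀ v → B v ≡ U v ∧ sinkᵇ o v) (Bq : ∀ v → B v ≡ true → proj₁ v ≡ q) where
    arcs = proj₁ base
    or = proj₁ (proj₂ base)
    ac = proj₂ (proj₂ base)
    r = deleteArcsInto B o

    B-sink : ∀ v → B v ≡ true → IsSink {m = m} o v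
    B-sink v bv = sinkᵇ-sound o v (∧≡true⁻ʳ {U v} (trans (sym (Bdef v)) bv))
    B-U : ∀ v → B v ≡ true → U v ≡ true
    B-U v bv = ∧≡true⁻ˡ {U v} (trans (sym (Bdef v)) bv)

    r-arc : ∀ u v → r u v ≡ true → o u v ≡ true × B v ≡ false
    r-arc u v a with B v
    ... | false = a , refl

    noSinkIn : NoSinkIn (U ∖ B) q r
    noSinkIn = (arcsR , orR , acR) , sinkR
      where
      notB : ∀ u → B u ≡ false → U u ≡ true → (U ∖ B) u ≡ true
      notB u bu uu rewrite bu | uu = refl
      arcsR : ArcsWithin (U ∖ B) r
      arcsR u v a with r-arc u v a
      ... | ouv , bv = notB u bu (proj₁ (arcs u v ouv)) , notB v bv (proj₂ (arcs u v ouv))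
        where
        bu : B u ≡ false
        bu with B u in e
        ... | false = refl
        ... | true = ⊥-elim (B-sink u e v ouv)
      orR : OrientsOn (U ∖ B) r
      orR u v uu uv rewrite not≡true⁻ (∧≡true⁻ʳ {U u} uu) | not≡true⁻ (∧≡true⁻ʳ {U v} uv) = or u v (∧≡true⁻ˡ {U u} uu) (∧≡true⁻ˡ {U v} uv)
      acR : IsAcyclic {m = m} r
      acR = IsAcyclic-mono (λ x y a → proj₁ (r-arc x y a)) ac
      sinkR : ∀ u → (U ∖ B) u ≡ true → IsSink {m = m} r u → ¬ proj₁ u ≡ q
      sinkR u uu s eq = true≢false (trans (sym bu) (not≡true⁻ (∧≡true⁻ʳ {U u} uu)))
        where
        sink-in-o : IsSink {m = m} o u
        sink-in-o w a with B w in bw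
        ... | true = true≢false (trans (sym a) (proj₁ (or u w (∧≡true⁻ˡ {U u} uu) (B-U w bw)) (trans eq (sym (Bq w bw)))))
        ... | false = s w arc
          where
          arc : r u w ≡ true
          arc rewrite bw = a
        bu : B u ≡ true
        bu = trans (Bdef u) (trans (cong (_∧ sinkᵇ o u) (∧≡true⁻ˡ {U u} uu)) (sinkᵇ-complete o u sink-in-o))

    addSinks-restores : addSinks U q B r ≈ o
    addSinks-restores u v with B v in bv
    ... | false = refl
    ... | true with U u in uu
    ...   | false with o u v in a
    ...     | false = refl
    ...     | true = ⊥-elim (true≢false (trans (sym (proj₁ (arcs u v a))) uu))
    addSinks-restores u v | true | true with B u in bu
    ...     | true = sym (sink-no-arc (B-sink u bu))
      where
      sink-no-arc : IsSink {m = m} o u → o u v ≡ false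
      sink-no-arc s with o u v in a
      ... | false = refl
      ... | true = ⊥-elim (s v a)
    ...     | false with proj₁ u F.≟ q
    ...       | yes eq with o u v in a
    ...         | false = refl
    ...         | true = ⊥-elim (true≢false (trans (sym a) (proj₁ (or u v uu (B-U v bv)) (trans eq (sym (Bq v bv))))))
    addSinks-restores u v | true | true | false | no ne with o u v in a
    ...         | true = refl
    ...         | false = ⊥-elim (B-sink v bv u (not≡false⁻ (trans (sym (proj₂ (or u v uu (B-U v bv)) (λ e → ne (trans e (Bq v bv))))) a)))

  addSinks-injective : ∀ {U q B o1 o2} → ArcsWithin (U ∖ B) o1 → ArcsWithin (U ∖ B) o2 → addSinks U q B o1 ≈ addSinks U q B o2 → o1 ≈ o2
  addSinks-injective {U} {q} {B} {o1} {o2} a1 a2 e u v with B v in bv | e u v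
  ... | false | eq = eq
  ... | true | _ = trans (no-arc-into-B o1 a1) (sym (no-arc-into-B o2 a2))
    where
    no-arc-into-B : ∀ o → ArcsWithin (U ∖ B) o → o u v ≡ false
    no-arc-into-B o a with o u v in x
    ... | false = refl
    ... | true = ⊥-elim (true≢false (trans (sym (proj₂ (a u v x))) (trans (cong (λ z → U v ∧ not z) bv) (BoolP.∧-zeroʳ (U v)))))

  addSinks-cong : ∀ {U q B o1 o2} → o1 ≈ o2 → addSinks U q B o1 ≈ addSinks U q B o2
  addSinks-cong {B = B} e u v with B v
  ... | true = refl
  ... | false = e u v

  addSinks-congˢ : ∀ {U q B B' o} → (∀ v → B v ≡ B' v) → addSinks U q B o ≈ addSinks U q B' o
  addSinks-congˢ {U} {q} {B} {B'} {o} e u v rewrite e u | e v = refl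

  NoSinkIn-congˢ : ∀ {U U' p o} → (∀ v → U v ≡ U' v) → NoSinkIn U p o → NoSinkIn U' p o
  NoSinkIn-congˢ e ((arcs , or , ac) , sk) =
    ((λ u v a → let (x , y) = arcs u v a in trans (sym (e u)) x , trans (sym (e v)) y) ,
     (λ u v uu uv → or u v (trans (e u) uu) (trans (e v) uv)) , ac) ,
    (λ u uu s → sk u (trans (e u) uu) s)

  NoSinkIn-cong : ∀ {U p o o'} → o ≈ o' → NoSinkIn U p o → NoSinkIn U p o'
  NoSinkIn-cong {o = o} {o'} e ((arcs , or , ac) , sk) =
    ((λ u v a → arcs u v (trans (e u v) a)) ,
     (λ u v uu uv → let (x , y) = or u v uu uv in
        (λ s → trans (sym (e u v)) (x s)) , (λ d → trans (sym (e u v)) (trans (y d) (cong not (e v u))))) ,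
     IsAcyclic-mono (λ x y a → trans (e x y) a) ac) ,
    (λ u uu s → sk u uu (IsSink-resp (≈-sym e) u s))

  embed : (q : Fin N) → (Fin (m q) → Bool) → VSet
  embed q g (r , i) with r F.≟ q
  ... | yes refl = g i
  ... | no _ = false

  embed-same : ∀ q g i → embed q g (q , i) ≡ g i
  embed-same q g i with q F.≟ q
  ... | yes refl = refl
  ... | no ne = ⊥-elim (ne refl)

  embed-part : ∀ q g v → embed q g v ≡ true → proj₁ v ≡ q
  embed-part q g (r , i) e with r F.≟ q
  ... | yes refl = refl

  part : VSet → (q : Fin N) → Fin (m q) → Bool
  part U q i = U (q , i)

  sizes-of : VSet → Vec ℕ N
  sizes-of U = tabulate (λ r → countTrue (m r) (part U r))

  sizes-of-∖ : ∀ U B q → (∀ v → B v ≡ true → U v ≡ true) → (∀ v → B v ≡ true → proj₁ v ≡ q) →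
    sizes-of (U ∖ B) ≡ lowerAt (sizes-of U) q (countTrue (m q) (part B q))
  sizes-of-∖ U B q BU Bq = vec-ext _ _ entry
    where
    entry : ∀ r → lookup (sizes-of (U ∖ B)) r ≡ lookup (lowerAt (sizes-of U) q (countTrue (m q) (part B q))) r
    entry r rewrite VP.lookup∘tabulate (λ r → countTrue (m r) (part (U ∖ B) r)) r with r F.≟ q
    ... | yes refl rewrite VP.lookup∘update r (sizes-of U) (lookup (sizes-of U) r ∸ countTrue (m r) (part B r))
                         | VP.lookup∘tabulate (λ r → countTrue (m r) (part U r)) r
      = countTrue-∖ (m r) (part U r) (part B r) (λ i → BU (r , i))
    ... | no ne rewrite VP.lookup∘update′ ne (sizes-of U) (lookup (sizes-of U) q ∸ countTrue (m q) (part B q))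
                      | VP.lookup∘tabulate (λ r → countTrue (m r) (part U r)) r
      = countTrue-cong (m r) (λ i → outside-q i)
      where
      outside-q : ∀ i → U (r , i) ∧ not (B (r , i)) ≡ U (r , i)
      outside-q i with B (r , i) in e
      ... | true = ⊥-elim (ne (Bq (r , i) e))
      ... | false = BoolP.∧-identityʳ (U (r , i))

  sizes-of-empty : ∀ U → Vec.sum (sizes-of U) ≡ 0 → ∀ v → U v ≡ false
  sizes-of-empty U e (r , i) = countTrue≡0⁻ (m r) (part U r)
    (trans (sym (VP.lookup∘tabulate (λ r → countTrue (m r) (part U r)) r))
      (trans (cong (λ z → lookup z r) (sum≡0⇒zeros (sizes-of U) e)) (VP.lookup-replicate r 0))) i

  anyL-false⁻ : ∀ f xs {x} → anyL f xs ≡ false → x ∈ xs → f x ≡ false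
  anyL-false⁻ f (y ∷ xs) e (here refl) with f y
  ... | false = refl
  anyL-false⁻ f (y ∷ xs) e (there mx) with f y
  ... | false = anyL-false⁻ f xs e mx

  nonempty : ∀ U s → Vec.sum (sizes-of U) ≡ suc s → Σ V λ v → U v ≡ true
  nonempty U s e with anyL U allV in a
  ... | true = anyL-elim U allV a
  ... | false = ⊥-elim (0≢s (trans (sym (trans (cong Vec.sum sizes-zero) (sum-zeros {N}))) e))
    where
    0≢s : 0 ≡ suc s → ⊥
    0≢s ()
    U-empty : ∀ v → U v ≡ false
    U-empty v = anyL-false⁻ U allV a (∈-allV v)
    sizes-zero : sizes-of U ≡ Vec.replicate _ 0
    sizes-zero = vec-ext (sizes-of U) (Vec.replicate _ 0) (λ r → trans (VP.lookup∘tabulate (λ r → countTrue (m r) (part U r)) r)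
          (trans (countTrue≡0⁺ (m r) (part U r) (λ i → U-empty (r , i))) (sym (VP.lookup-replicate r 0))))

  noArcs : Rel
  noArcs _ _ = false

  sinkCandidates : VSet → (q : Fin N) → List VSet
  sinkCandidates U q = map (embed q) (nonemptySubsetsOf (m q) (part U q))

  candidates : VSet → Fin N → Fin N → List VSet
  candidates U p q = if does (q F.≟ p) then [] else sinkCandidates U q

  unlessEmptyL : ℕ → List Rel → List Rel
  unlessEmptyL zero _ = noArcs ∷ []
  unlessEmptyL (suc _) xs = xs

  -- Lists the acyclic orientations of K[U] with no sink in part p, mirroring countRec.
  enumeration : ℕ → VSet → Fin N → List Rel
  enumeration zero U p = noArcs ∷ []
  enumeration (suc f) U p = unlessEmptyL (Vec.sum (sizes-of U)) (concatMap (λ q → concatMap (λ B → map (addSinks U q B) (enumeration f (U ∖ B) q)) (candidates U p q)) (allFin N))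

  sizes-of-∖-embed : ∀ U q g → g ⊆ᵇ part U q → sizes-of (U ∖ embed q g) ≡ lowerAt (sizes-of U) q (countTrue (m q) g)
  sizes-of-∖-embed U q g le = trans (sizes-of-∖ U (embed q g) q BU (embed-part q g))
                            (cong (λ z → lowerAt (sizes-of U) q z) (countTrue-cong (m q) (embed-same q g)))
    where
    BU : ∀ v → embed q g v ≡ true → U v ≡ true
    BU (r , i) e with r F.≟ q
    ... | yes refl = le i e

  enumeration-length : ∀ f U p → + length (enumeration f U p) ≡ countRec f (sizes-of U) p
  enumeration-length zero U p = refl
  enumeration-length (suc f) U p with Vec.sum (sizes-of U)
  ... | zero = refl
  ... | suc _ = trans (length-concatMap G (allFin N)) (trans (sumList-tabulate (λ x → x) (λ q → + length (G q))) (sumFin-cong pq))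
    where
    G = λ q → concatMap (λ B → map (addSinks U q B) (enumeration f (U ∖ B) q)) (candidates U p q)
    pq : ∀ q → + length (G q) ≡ (if does (q F.≟ p) then 0ℤ else
                  sum1to (lookup (sizes-of U) q) (λ b → binomℤ (lookup (sizes-of U) q) b * countRec f (lowerAt (sizes-of U) q b) q))
    pq q with does (q F.≟ p)
    ... | true = refl
    ... | false = begin
      + length (concatMap (λ B → map (addSinks U q B) (enumeration f (U ∖ B) q)) (map (embed q) NS))
        ≡⟨ length-concatMap (λ B → map (addSinks U q B) (enumeration f (U ∖ B) q)) (map (embed q) NS) ⟩
      sumList (map (embed q) NS) (λ B → + length (map (addSinks U q B) (enumeration f (U ∖ B) q)))
        ≡⟨ sumList-map (embed q) NS (λ B → + length (map (addSinks U q B) (enumeration f (U ∖ B) q))) ⟩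
      sumList NS (λ g → + length (map (addSinks U q (embed q g)) (enumeration f (U ∖ embed q g) q)))
        ≡⟨ sumList-cong NS (λ g mg → trans (cong +_ (LP.length-map (addSinks U q (embed q g)) (enumeration f (U ∖ embed q g) q)))
                            (trans (enumeration-length f (U ∖ embed q g) q) (cong (λ z → countRec f z q) (sizes-of-∖-embed U q g (proj₁ (nonemptySubsetsOf-⊆ᵇ (m q) (part U q) mg)))))) ⟩
      sumList NS (λ g → countRec f (lowerAt (sizes-of U) q (countTrue (m q) g)) q)
        ≡⟨ nonemptySubsetsOf-sum (m q) (part U q) (λ b → countRec f (lowerAt (sizes-of U) q b) q) ⟩
      sum1to (countTrue (m q) (part U q)) (λ b → binomℤ (countTrue (m q) (part U q)) b * countRec f (lowerAt (sizes-of U) q b) q)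
        ≡⟨ cong (λ z → sum1to z (λ b → binomℤ z b * countRec f (lowerAt (sizes-of U) q b) q)) (sym (VP.lookup∘tabulate (λ r → countTrue (m r) (part U r)) q)) ⟩
      sum1to (lookup (sizes-of U) q) (λ b → binomℤ (lookup (sizes-of U) q) b * countRec f (lowerAt (sizes-of U) q b) q) ∎
      where
      open ≡-Reasoning
      NS = nonemptySubsetsOf (m q) (part U q)

  empty-enumerates : ∀ U p → (∀ v → U v ≡ false) → Enumerates {m = m} (NoSinkIn U p) (noArcs ∷ [])
  empty-enumerates U p e = Enumerates-single noArcs (λ o val u v → no-arcs o val u v) (((λ u v ()) , (λ u v uu _ → ⊥-elim (true≢false (trans (sym uu) (e u)))) , acyc) ,
                                                             (λ u uu _ _ → true≢false (trans (sym uu) (e u))))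
    where
    no-arcs : ∀ o → NoSinkIn U p o → ∀ u v → o u v ≡ noArcs u v
    no-arcs o val u v with o u v in a
    ... | false = refl
    ... | true = ⊥-elim (true≢false (trans (sym (proj₁ (proj₁ (proj₁ val) u v a))) (e u)))
    acyc : IsAcyclic {m = m} noArcs
    acyc (v , [] , (() ∷ _) , _)
    acyc (v , x ∷ l , (() ∷ _) , _)

  candidates-∈ : ∀ U p q {B} → B ∈ candidates U p q → ¬ q ≡ p × Σ (Fin (m q) → Bool) λ g → g ∈ nonemptySubsetsOf (m q) (part U q) × B ≡ embed q g
  candidates-∈ U p q {B} mB with q F.≟ p
  ... | no ne = ne , ∈-map⁻ (embed q) mB

  embed-⊆-nonempty : ∀ U q g → g ∈ nonemptySubsetsOf (m q) (part U q) →
    (∀ v → embed q g v ≡ true → U v ≡ true) × (Σ V λ b → embed q g b ≡ true)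
  embed-⊆-nonempty U q g mg with nonemptySubsetsOf-⊆ᵇ (m q) (part U q) mg
  ... | le , i , gi = BU , (q , i) , trans (embed-same q g i) gi
    where
    BU : ∀ v → embed q g v ≡ true → U v ≡ true
    BU (r , j) e with r F.≟ q
    ... | yes refl = le j e

  ExtendsWith : VSet → Fin N → VSet → Rel → Set
  ExtendsWith U q B o = Σ Rel λ o'' → NoSinkIn (U ∖ B) q o'' × o ≈ addSinks U q B o''

  sinks-of-extension : ∀ U q g → g ∈ nonemptySubsetsOf (m q) (part U q) → ∀ a → ExtendsWith U q (embed q g) a → ∀ v → embed q g v ≡ U v ∧ sinkᵇ a v
  sinks-of-extension U q g mg a (o'' , val , e) v with embed-⊆-nonempty U q g mg
  ... | BU , ne = trans (sym (AddSinks.Sinks.sinks≡B {U} {q} {embed q g} {o''} BU (embed-part q g) (proj₁ val) ne (proj₂ val) v))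
                        (cong (U v ∧_) (sinkᵇ-resp (≈-sym e) v))

  FromPart : VSet → Fin N → Fin N → Rel → Set
  FromPart U p q o = Any (λ B → ExtendsWith U q B o) (candidates U p q)

  sizes-of-∖-embed-≤ : ∀ f U q g → Vec.sum (sizes-of U) ≤ suc f → g ∈ nonemptySubsetsOf (m q) (part U q) →
    Vec.sum (sizes-of (U ∖ embed q g)) ≤ f
  sizes-of-∖-embed-≤ f U q g le mg with nonemptySubsetsOf-⊆ᵇ (m q) (part U q) mg
  ... | g⊆U , i , gi rewrite sizes-of-∖-embed U q g g⊆U =
    m+n≤1+o⇒m≤o (Vec.sum (lowerAt (sizes-of U) q b)) b f (countTrue-pos (m q) g i gi)
      (subst (_≤ suc f) (sym (sum-lowerAt (sizes-of U) q b b≤)) le)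
    where
    b = countTrue (m q) g
    b≤ : b ≤ lookup (sizes-of U) q
    b≤ rewrite VP.lookup∘tabulate (λ r → countTrue (m r) (part U r)) q = countTrue-mono (m q) g (part U q) g⊆U

  ExtendsWith-disjoint : ∀ U p q →
    AllPairs (λ B B' → ∀ a b → ExtendsWith U q B a → ExtendsWith U q B' b → ¬ a ≈ b) (candidates U p q)
  ExtendsWith-disjoint U p q with does (q F.≟ p)
  ... | true = []
  ... | false = AllPairsₚ.map⁺
      (AllPairs-map-All
        (λ {g} {g'} mg mg' ne a b pa pb e → ne (λ i → trans (sym (embed-same q g i))
           (trans (sinks-of-extension U q g mg a pa (q , i)) (trans (cong (U (q , i) ∧_) (sinkᵇ-resp e (q , i)))
             (trans (sym (sinks-of-extension U q g' mg' b pb (q , i))) (embed-same q g' i))))))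
        (All.tabulate (λ mg → mg)) (nonemptySubsetsOf-distinct (m q) (part U q)))

  FromPart-disjoint : ∀ U p → AllPairs (λ q q' → ∀ a b → FromPart U p q a → FromPart U p q' b → ¬ a ≈ b) (allFin N)
  FromPart-disjoint U p = AllPairsₚ.tabulate⁺ (λ {q} {q'} → disjoint q q')
    where
    disjoint : ∀ q q' → ¬ q ≡ q' → ∀ a b → FromPart U p q a → FromPart U p q' b → ¬ a ≈ b
    disjoint q q' ne a b pa pb e with find pa | find pb
    ... | B , mB , pa' | B' , mB' , pb' with candidates-∈ U p q mB | candidates-∈ U p q' mB'
    ... | _ , g , mg , refl | _ , g' , mg' , refl with embed-⊆-nonempty U q g mg
    ...   | _ , (w , gw) = ne (trans (sym (embed-part q g w gw)) (embed-part q' g' w g'w))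
      where
      g'w : embed q' g' w ≡ true
      g'w = trans (sinks-of-extension U q' g' mg' b pb' w) (trans (cong (U w ∧_) (sinkᵇ-resp (≈-sym e) w))
               (trans (sym (sinks-of-extension U q g mg a pa' w)) gw))

  FromPart⇒NoSinkIn : ∀ U p o → Any (λ q → FromPart U p q o) (allFin N) → NoSinkIn U p o
  FromPart⇒NoSinkIn U p o an with find an
  ... | q , _ , pq with find pq
  ...   | B , mB , (o' , val , e) with candidates-∈ U p q mB
  ...     | qp , g , mg , refl with embed-⊆-nonempty U q g mg
  ...       | BU , ne = NoSinkIn-cong (≈-sym e)
               (AddSinks.Sinks.noSinkIn {U} {q} {embed q g} {o'} BU (embed-part q g) (proj₁ val) ne (proj₂ val) p qp)

  -- The sinks lie in one part, since vertices of different parts are joined by an arc.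
  sinks-form-candidate : ∀ U o → AcyclicOn U o → ∀ w → U w ≡ true → IsSink {m = m} o w →
    Any (λ B → ExtendsWith U (proj₁ w) B o) (sinkCandidates U (proj₁ w))
  sinks-form-candidate U o (arcs , or , ac) w uw sw =
    Anyₚ.map⁺ (Any.map (λ {g'} e' →
      deleteArcsInto B₀ o , NoSinkIn-congˢ {U ∖ B₀} {U ∖ embed q g'} (λ v → cong (λ z → U v ∧ not z) (B≗ g' e' v)) noSink ,
      ≈-trans (≈-sym restore) (addSinks-congˢ {U} {q} {B₀} {embed q g'} {deleteArcsInto B₀ o} (B≗ g' e'))) candidate)
    where
    q = proj₁ w
    B₀ : VSet
    B₀ v = U v ∧ sinkᵇ o v
    B₀-in-q : ∀ v → B₀ v ≡ true → proj₁ v ≡ q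
    B₀-in-q v bv with proj₁ v F.≟ q
    ... | yes e' = e'
    ... | no ne with ArcFacts.orient-or {U} {o} arcs or v w (∧≡true⁻ˡ {U v} bv) uw ne
    ...   | inj₁ a = ⊥-elim (sinkᵇ-sound o v (∧≡true⁻ʳ {U v} bv) w a)
    ...   | inj₂ a = ⊥-elim (sw v a)
    noSink : NoSinkIn (U ∖ B₀) q (deleteArcsInto B₀ o)
    noSink = RemoveSinks.noSinkIn {U} {q} {B₀} {o} (arcs , or , ac) (λ v → refl) B₀-in-q
    restore : addSinks U q B₀ (deleteArcsInto B₀ o) ≈ o
    restore = RemoveSinks.addSinks-restores {U} {q} {B₀} {o} (arcs , or , ac) (λ v → refl) B₀-in-q
    candidate : Any (λ g' → part B₀ q ≗ g') (nonemptySubsetsOf (m q) (part U q))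
    candidate = nonemptySubsetsOf-complete (m q) (part U q) (part B₀ q) (λ i e' → ∧≡true⁻ˡ {U (q , i)} e')
      (proj₂ w , trans (cong (U w ∧_) (sinkᵇ-complete o w sw)) (cong (_∧ true) uw))
    B≗ : ∀ g' → part B₀ q ≗ g' → ∀ v → B₀ v ≡ embed q g' v
    B≗ g' e' (r , i) with r F.≟ q
    ... | yes refl = e' i
    ... | no ne with B₀ (r , i) in bv
    ...   | true = ⊥-elim (ne (B₀-in-q (r , i) bv))
    ...   | false = refl

  NoSinkIn⇒FromPart : ∀ U p s → Vec.sum (sizes-of U) ≡ suc s → ∀ o → NoSinkIn U p o → Any (λ q → FromPart U p q o) (allFin N)
  NoSinkIn⇒FromPart U p s eq o (acyclic@(arcs , or , ac) , noSink) with nonempty U s eq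
  ... | u , uu with SinkExistence.sinkExists {U} {o} arcs or ac u uu
  ...   | w , uw , sw = Any.map (λ { refl → fromPart }) (∈-allFin (proj₁ w))
    where
    fromPart : FromPart U p (proj₁ w) o
    fromPart = subst (λ z → Any (λ B → ExtendsWith U (proj₁ w) B o) (if z then [] else sinkCandidates U (proj₁ w)))
                     (sym (dec-false (proj₁ w F.≟ p) (noSink w uw sw))) (sinks-form-candidate U o acyclic w uw sw)

  enumeration-enumerates : ∀ f U p → Vec.sum (sizes-of U) ≤ f → Enumerates {m = m} (NoSinkIn U p) (enumeration f U p)
  enumeration-enumerates zero U p le = empty-enumerates U p (sizes-of-empty U (ℕP.n≤0⇒n≡0 le))
  enumeration-enumerates (suc f) U p le with Vec.sum (sizes-of U) in eq
  ... | zero = empty-enumerates U p (sizes-of-empty U eq)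
  ... | suc s = Enumerates-⇔ (FromPart⇒NoSinkIn U p) (NoSinkIn⇒FromPart U p s eq)
      (Enumerates-concatMap (allFin N) _ (FromPart U p) (λ q _ → fromPart q) (FromPart-disjoint U p))
    where
    withSinks : ∀ q B → B ∈ candidates U p q →
      Enumerates {m = m} (ExtendsWith U q B) (map (addSinks U q B) (enumeration f (U ∖ B) q))
    withSinks q B mB with candidates-∈ U p q mB
    ... | _ , g , mg , refl =
      Enumerates-map (addSinks U q (embed q g)) (λ x y e → addSinks-cong {U} {q} {embed q g} e)
        (λ x y vx vy e → addSinks-injective {U} {q} {embed q g} (proj₁ (proj₁ vx)) (proj₁ (proj₁ vy)) e)
        (enumeration-enumerates f (U ∖ embed q g) q (sizes-of-∖-embed-≤ f U q g (subst (_≤ suc f) (sym eq) le) mg))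
    fromPart : ∀ q → Enumerates {m = m} (FromPart U p q) (concatMap (λ B → map (addSinks U q B) (enumeration f (U ∖ B) q)) (candidates U p q))
    fromPart q = Enumerates-concatMap (candidates U p q) _ (ExtendsWith U q) (withSinks q) (ExtendsWith-disjoint U p q)

  whole : VSet
  whole _ = true

  isVertex : V → VSet
  isVertex s v = does (v ≟V s)

  uniqueSinkEnumeration : V → List Rel
  uniqueSinkEnumeration s =
    map (addSinks whole (proj₁ s) (isVertex s)) (enumeration (Vec.sum (sizes-of (whole ∖ isVertex s))) (whole ∖ isVertex s) (proj₁ s))

  module _ (s : V) where
    private
      p = proj₁ s
      rest = whole ∖ isVertex s

      isVertex-≡ : ∀ v → isVertex s v ≡ true → v ≡ s
      isVertex-≡ v e with v ≟V s
      ... | yes eq = eq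

      isVertex-self : isVertex s s ≡ true
      isVertex-self = dec-true (s ≟V s) refl

      isVertex-part : ∀ v → isVertex s v ≡ true → proj₁ v ≡ p
      isVertex-part v e = cong proj₁ (isVertex-≡ v e)

      fromRest : ∀ o → (Σ Rel λ x → NoSinkIn rest p x × o ≈ addSinks whole p (isVertex s) x) → AcyclicWithUniqueSink {m = m} s o
      fromRest o (x , val , e) = orO , acO , sinkO , uniq
        where
        module E = AddSinks {whole} {p} {isVertex s} {x} (λ _ _ → refl) isVertex-part (proj₁ val)
        module ES = E.Sinks (s , isVertex-self) (proj₂ val)
        ex = addSinks whole p (isVertex s) x
        orO : IsOrientation {m = m} o
        orO u v = (λ sp → trans (e u v) (proj₁ (E.orientsOn u v refl refl) sp)) ,
                  (λ dp → trans (e u v) (trans (proj₂ (E.orientsOn u v refl refl) dp) (cong not (sym (e v u)))))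
        acO : IsAcyclic {m = m} o
        acO = IsAcyclic-mono (λ a b arc → trans (sym (e a b)) arc) E.acyclic
        sinkO : IsSink {m = m} o s
        sinkO = IsSink-resp (≈-sym e) s (sinkᵇ-sound ex s (trans (ES.sinks≡B s) isVertex-self))
        uniq : ∀ u → IsSink {m = m} o u → u ≡ s
        uniq u su = isVertex-≡ u (trans (sym (ES.sinks≡B u)) (sinkᵇ-complete ex u (IsSink-resp e u su)))

      toRest : ∀ o → AcyclicWithUniqueSink {m = m} s o → Σ Rel λ x → NoSinkIn rest p x × o ≈ addSinks whole p (isVertex s) x
      toRest o (orO , acO , sinkO , uniq) =
        deleteArcsInto (isVertex s) o , RemoveSinks.noSinkIn acyclic sinks isVertex-part , ≈-sym (RemoveSinks.addSinks-restores acyclic sinks isVertex-part)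
        where
        acyclic : AcyclicOn whole o
        acyclic = (λ u v _ → refl , refl) , (λ u v _ _ → orO u v) , acO
        sinks : ∀ v → isVertex s v ≡ whole v ∧ sinkᵇ o v
        sinks v with v ≟V s
        ... | yes refl = sym (sinkᵇ-complete o s sinkO)
        ... | no ne with sinkᵇ o v in sb
        ...   | false = refl
        ...   | true = ⊥-elim (ne (uniq v (sinkᵇ-sound o v sb)))

      sizes-of-rest : sizes-of rest ≡ lowerAt (tabulate m) p 1
      sizes-of-rest = trans (sizes-of-∖ whole (isVertex s) p (λ _ _ → refl) isVertex-part)
        (cong₂ (λ a b → lowerAt a p b) (VP.tabulate-cong (λ r → countTrue-all (m r)))
          (countTrue-single (m p) (part (isVertex s) p) (proj₂ s) isVertex-self (λ i e → index-≡ (isVertex-≡ (p , i) e))))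
        where
        index-≡ : ∀ {i} → (p , i) ≡ s → i ≡ proj₂ s
        index-≡ refl = refl

    uniqueSinkEnumeration-enumerates : Enumerates {m = m} (AcyclicWithUniqueSink {m = m} s) (uniqueSinkEnumeration s)
    uniqueSinkEnumeration-enumerates = Enumerates-⇔ fromRest toRest
      (Enumerates-map (addSinks whole p (isVertex s)) (λ x y e → addSinks-cong {whole} {p} {isVertex s} e)
        (λ x y vx vy e → addSinks-injective {whole} {p} {isVertex s} (proj₁ (proj₁ vx)) (proj₁ (proj₁ vy)) e)
        (enumeration-enumerates _ rest p ℕP.≤-refl))

    uniqueSinkEnumeration-length : + length (uniqueSinkEnumeration s) ≡ 𝒰 (tabulate m)
    uniqueSinkEnumeration-length = begin
      + length (uniqueSinkEnumeration s)
        ≡⟨ cong +_ (LP.length-map (addSinks whole p (isVertex s)) (enumeration (Vec.sum (sizes-of rest)) rest p)) ⟩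
      + length (enumeration (Vec.sum (sizes-of rest)) rest p)
        ≡⟨ enumeration-length (Vec.sum (sizes-of rest)) rest p ⟩
      countRec (Vec.sum (sizes-of rest)) (sizes-of rest) p
        ≡⟨ countRec≡𝒩 (Vec.sum (sizes-of rest)) (sizes-of rest) p ℕP.≤-refl ⟩
      𝒩 (sizes-of rest) p
        ≡⟨ cong (λ a → 𝒩 a p) sizes-of-rest ⟩
      𝒩 (lowerAt (tabulate m) p 1) p
        ≡⟨ 𝒩≡𝒰 (lowerAt (tabulate m) p 1) p ⟩
      𝒰 (lowerAt (tabulate m) p 1 [ p ]≔ suc (lookup (lowerAt (tabulate m) p 1) p))
        ≡⟨ cong 𝒰 (increment-lowerAt-1 (tabulate m) p m[p]≥1) ⟩
      𝒰 (tabulate m) ∎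
      where
      open ≡-Reasoning
      m[p]≥1 : 1 ≤ lookup (tabulate m) p
      m[p]≥1 rewrite VP.lookup∘tabulate m p = ℕ.>-nonZero⁻¹ (m p) {{FP.nonZeroIndex (proj₂ s)}}

theorem6p7 : (K n₁ : ℕ) (ns : Fin K → ℕ) → 1 ≤ K → ((j : Fin K) → 1 ≤ ns j) →
    (s : Vertex (sizes K n₁ ns)) →
    Σ ℕ λ c → NumAcyclicUniqueSink (sizes K n₁ ns) s c × + c ≡ formula K n₁ ns
theorem6p7 K n₁ ns _ ns≥1 s =
  length (uniqueSinkEnumeration s) ,
  (uniqueSinkEnumeration s , uniqueSinkEnumeration-enumerates s , refl) ,
  trans (uniqueSinkEnumeration-length s) (𝒰≡formula K n₁ ns ns≥1)
  where open Orientations (sizes K n₁ ns)
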